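{- For any wheel $W_n$ of order $n\ge 5$, $\gamma_{tc}(M(W_n))=\lceil 2n/3\rceil$.
   Context: All graphs are finite, simple and undirected. The wheel $W_n$ of order $n$ is the graph with vertices $v_0,v_1,\dots,v_{n-1}$ whose edges are $v_0v_i$ for $1\le i\le n-1$ together with the edges of the cycle $v_1v_2\cdots v_{n-1}v_1$. For a graph $H$, a set $D\subseteq V(H)$ is a total dominating set if every vertex of $H$ has a neighbor in $D$. A set $D\subseteq V(H)$ is a total outer-connected dominating set of $H$ if $D$ is a total dominating set and the induced subgraph $H[V(H)\setminus D]$ is connected; $\gamma_{tc}(H)$ denotes the minimum cardinality of a total outer-connected dominating set of $H$. The middle graph $M(G)$ of a graph $G$ has vertex set $V(G)\cup E(G)$, where two elements $x,y$ are adjacent iff either $x,y\in E(G)$ are edges of $G$ sharing an endpoint, or one of them is a vertex of $G$ and the other is an edge of $G$ incident to it. -}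

module Defs where

open import Data.Nat using (ℕ; zero; suc; _+_; _*_; _≤_; _<ᵇ_; _≡ᵇ_; _∸_)
open import Data.Nat.DivMod using (_/_)
open import Data.Bool using (Bool; true; false; _∧_; _∨_; not)
open import Data.Fin using (Fin; toℕ; splitAt)
open import Data.Fin.Properties using (_≟_)
open import Data.Fin.Subset using (Subset; _∈_; _∉_; ∣_∣)
open import Data.List using (List; []; _∷_; length; filterᵇ; cartesianProduct; lookup; allFin)
open import Data.Product using (_×_; _,_; proj₁; proj₂; ∃)
open import Data.Sum using (_⊎_; inj₁; inj₂)
open import Relation.Nullary.Decidable using (⌊_⌋)
open import Relation.Binary.PropositionalEquality using (_≡_)

record Graph : Set where
  field
    order : ℕ
    adj   : Fin order → Fin order → Bool

open Graph public

Adj : (H : Graph) → Fin (order H) → Fin (order H) → Set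
Adj H u v = adj H u v ≡ true

IsTotalDominating : (H : Graph) → Subset (order H) → Set
IsTotalDominating H D = ∀ v → ∃ λ u → u ∈ D × Adj H v u

-- Walks in H all of whose vertices lie outside D (i.e. walks in H[V ∖ D]).
data WalkOutside (H : Graph) (D : Subset (order H)) : Fin (order H) → Fin (order H) → Set where
  here  : ∀ {u} → u ∉ D → WalkOutside H D u u
  step  : ∀ {u w v} → u ∉ D → Adj H u w → WalkOutside H D w v → WalkOutside H D u v

OuterConnected : (H : Graph) → Subset (order H) → Set
OuterConnected H D = ∀ u v → u ∉ D → v ∉ D → WalkOutside H D u v

IsTOCDS : (H : Graph) → Subset (order H) → Set
IsTOCDS H D = IsTotalDominating H D × OuterConnected H D

GammaTC≡ : Graph → ℕ → Set
GammaTC≡ H k = (∃ λ D → IsTOCDS H D × ∣ D ∣ ≡ k) × (∀ D → IsTOCDS H D → k ≤ ∣ D ∣)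

edges : (G : Graph) → List (Fin (order G) × Fin (order G))
edges G = filterᵇ (λ p → (toℕ (proj₁ p) <ᵇ toℕ (proj₂ p)) ∧ adj G (proj₁ p) (proj₂ p))
                  (cartesianProduct (allFin (order G)) (allFin (order G)))

_==_ : ∀ {n} → Fin n → Fin n → Bool
x == y = ⌊ x ≟ y ⌋

-- Middle graph M(G): vertices are Fin (order G + number of edges);
-- the first block is V(G), the second block is E(G) (indexed into edges G).
middle : Graph → Graph
middle G = record { order = order G + length (edges G) ; adj = madj }
  where
    E = edges G
    incident : Fin (order G) → Fin (length E) → Bool
    incident x e = (x == proj₁ (lookup E e)) ∨ (x == proj₂ (lookup E e))
    madj : Fin (order G + length E) → Fin (order G + length E) → Bool
    madj a b with splitAt (order G) a | splitAt (order G) b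
    ... | inj₁ x | inj₁ y = false
    ... | inj₁ x | inj₂ e = incident x e
    ... | inj₂ e | inj₁ y = incident y e
    ... | inj₂ e | inj₂ f = not (e == f)
                            ∧ (incident (proj₁ (lookup E e)) f ∨ incident (proj₂ (lookup E e)) f)

-- Wheel W_n: vertex 0 is the hub v0; vertices 1..n-1 form the cycle v1 v2 ... v(n-1) v1.
wheelAdj : (n : ℕ) → Fin n → Fin n → Bool
wheelAdj n a b = hub ∨ rim
  where
    i = toℕ a
    j = toℕ b
    hub = ((i ≡ᵇ 0) ∧ not (j ≡ᵇ 0)) ∨ (not (i ≡ᵇ 0) ∧ (j ≡ᵇ 0))
    consecutive : ℕ → ℕ → Bool
    consecutive x y = (suc x ≡ᵇ y) ∨ (suc y ≡ᵇ x)
    rim = not (i ≡ᵇ 0) ∧ not (j ≡ᵇ 0)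
          ∧ (consecutive i j ∨ ((i ≡ᵇ 1) ∧ (j ≡ᵇ (n ∸ 1))) ∨ ((j ≡ᵇ 1) ∧ (i ≡ᵇ (n ∸ 1))))

wheel : ℕ → Graph
wheel n = record { order = n ; adj = wheelAdj n }

⌈2n/3⌉ : ℕ → ℕ
⌈2n/3⌉ n = (2 * n + 2) / 3

-- Group the elements of M(Wₙ) other than the hub v₀ into the m = n − 1 blocks Bᵢ = {v₀vᵢ, vᵢvᵢ₊₁, vᵢ}
-- around the rim.  Lower bound (total domination alone suffices): a discharging argument with a
-- potential τ on consecutive blocks gives 3|D ∩ Bᵢ| ≥ 2 + νᵢ + τᵢ₊₁ − τᵢ with a surplus νᵢ ≥ 0, so
-- 3|D| ≥ 2m + 3[v₀ ∈ D] + Σνᵢ after telescoping; if v₀ ∉ D, the spoke dominating v₀ forces Σνᵢ ≥ 2.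
-- Either way 3|D| ≥ 2n.  Upper bound: the spokes v₀v₁, v₀v₂ and the rim edges vᵢvᵢ₊₁ with
-- 3 ≤ i ≤ m, i ≢ 2 (mod 3), are ⌈2n/3⌉ elements; every element has a neighbour among them, and every
-- other element reaches v₀ through a free spoke v₀vᵢ, i ≥ 3.
module Submission where

open import Defs
open import Data.Bool using (Bool; true; false; _∧_; _∨_; not; if_then_else_; T)
open import Data.Bool.Properties using (T-∧)
open import Data.Empty using (⊥)
open import Data.Fin using (Fin; toℕ; fromℕ<; splitAt)
open import Data.Fin.Properties
  using (toℕ<n; toℕ-fromℕ<; toℕ-injective; splitAt⁻¹-↑ˡ; splitAt⁻¹-↑ʳ; toℕ-↑ˡ; toℕ-↑ʳ)
  renaming (_≟_ to _≟ᶠ_)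
open import Data.Fin.Subset using (Subset; ∣_∣; _∈_; _∉_)
open import Data.List using (List; []; _∷_; _++_; map; length; filterᵇ; cartesianProduct; allFin; lookup)
open import Data.List.Properties
  using (map-++; map-tabulate; length-map; length-++; filter-++; ++-identityʳ; cartesianProductWith-distribʳ-++)
open import Data.Nat
  using (ℕ; zero; suc; _+_; _*_; _∸_; _≤_; _<_; z≤n; s≤s; s≤s⁻¹; z<s; _<ᵇ_; _≡ᵇ_; _≤ᵇ_; pred; _/_)
open import Data.Nat.DivMod using (+-distrib-/-∣ˡ; +-distrib-/-∣ʳ; m*n/n≡m; /-monoˡ-≤)
open import Data.Nat.Divisibility using (divides)
open import Data.Nat.Properties
open import Data.Nat.Tactic.RingSolver using (solve-∀)
open import Data.Product using (_×_; _,_; proj₁; proj₂; ∃; Σ)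
open import Data.Sum using (_⊎_; inj₁; inj₂)
open import Data.Unit using (tt)
open import Data.Vec using (Vec; []; _∷_; tabulate) renaming (lookup to lookupᵛ)
open import Data.Vec.Properties using ([]=⇒lookup; lookup⇒[]=; lookup∘tabulate)
open import Function using (_∘_; Equivalence)
open import Relation.Binary.PropositionalEquality
open import Relation.Nullary using (¬_; yes; no; contradiction)
open import Relation.Nullary.Decidable using (T?)

bit : Bool → ℕ
bit true  = 1
bit false = 0

true≢false : ∀ {b} → b ≡ true → b ≡ false → ⊥
true≢false refl ()

bool-cases : ∀ b → b ≡ true ⊎ b ≡ false
bool-cases true  = inj₁ refl
bool-cases false = inj₂ refl

∨-introˡ : ∀ {p} q → p ≡ true → (p ∨ q) ≡ true
∨-introˡ q refl = refl

∨-introʳ : ∀ p {q} → q ≡ true → (p ∨ q) ≡ true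
∨-introʳ true  _ = refl
∨-introʳ false e = e

∨-elim : ∀ {p q} → (p ∨ q) ≡ true → p ≡ true ⊎ q ≡ true
∨-elim {true}  _ = inj₁ refl
∨-elim {false} e = inj₂ e

∨-falseˡ : ∀ {p q} → (p ∨ q) ≡ false → p ≡ false
∨-falseˡ {false} _ = refl

∨-falseʳ : ∀ {p q} → (p ∨ q) ≡ false → q ≡ false
∨-falseʳ {false} e = e

∧-intro : ∀ {p q} → p ≡ true → q ≡ true → (p ∧ q) ≡ true
∧-intro refl refl = refl

not-∧-intro : ∀ {p q} → p ≡ false → q ≡ true → (not p ∧ q) ≡ true
not-∧-intro refl e = e

not-∧-elimˡ : ∀ {p q} → (not p ∧ q) ≡ true → p ≡ false
not-∧-elimˡ {false} _ = refl

not-∧-elim : ∀ {p q} → p ≡ false → (not p ∧ q) ≡ true → q ≡ true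
not-∧-elim refl e = e

∨-interchange : ∀ a b c d → ((a ∨ b) ∨ (c ∨ d)) ≡ ((a ∨ c) ∨ (b ∨ d))
∨-interchange true  b     c     d = refl
∨-interchange false true  true  d = refl
∨-interchange false true  false d = refl
∨-interchange false false c     d = refl

≡ᵇ-refl : ∀ x → (x ≡ᵇ x) ≡ true
≡ᵇ-refl zero    = refl
≡ᵇ-refl (suc x) = ≡ᵇ-refl x

≢⇒≡ᵇ≡false : ∀ x y → x ≢ y → (x ≡ᵇ y) ≡ false
≢⇒≡ᵇ≡false zero    zero    x≢y = contradiction refl x≢y
≢⇒≡ᵇ≡false zero    (suc y) _   = refl
≢⇒≡ᵇ≡false (suc x) zero    _   = refl
≢⇒≡ᵇ≡false (suc x) (suc y) x≢y = ≢⇒≡ᵇ≡false x y (x≢y ∘ cong suc)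

<⇒≡ᵇ≡false : ∀ {x y} → x < y → (x ≡ᵇ y) ≡ false
<⇒≡ᵇ≡false {x} {y} x<y = ≢⇒≡ᵇ≡false x y (<⇒≢ x<y)

>⇒≡ᵇ≡false : ∀ {x y} → y < x → (x ≡ᵇ y) ≡ false
>⇒≡ᵇ≡false {x} {y} y<x = ≢⇒≡ᵇ≡false x y (>⇒≢ y<x)

≡ᵇ≡true⇒≡ : ∀ x y → (x ≡ᵇ y) ≡ true → x ≡ y
≡ᵇ≡true⇒≡ x y e = ≡ᵇ⇒≡ x y (subst T (sym e) tt)

∨-≡ᵇ-elim : ∀ x p q → ((x ≡ᵇ p) ∨ (x ≡ᵇ q)) ≡ true → x ≡ p ⊎ x ≡ q
∨-≡ᵇ-elim x p q e with ∨-elim {x ≡ᵇ p} e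
... | inj₁ e₁ = inj₁ (≡ᵇ≡true⇒≡ x p e₁)
... | inj₂ e₂ = inj₂ (≡ᵇ≡true⇒≡ x q e₂)

<⇒<ᵇ≡true : ∀ x y → x < y → (x <ᵇ y) ≡ true
<⇒<ᵇ≡true zero    (suc y) _         = refl
<⇒<ᵇ≡true (suc x) (suc y) (s≤s x<y) = <⇒<ᵇ≡true x y x<y

≥⇒<ᵇ≡false : ∀ x y → y ≤ x → (x <ᵇ y) ≡ false
≥⇒<ᵇ≡false x       zero    _         = refl
≥⇒<ᵇ≡false (suc x) (suc y) (s≤s y≤x) = ≥⇒<ᵇ≡false x y y≤x

allBool : ∀ n → (Vec Bool n → Bool) → Bool
allBool zero    P = P []
allBool (suc n) P = allBool n (P ∘ (true ∷_)) ∧ allBool n (P ∘ (false ∷_))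

allBool-sound : ∀ n P → T (allBool n P) → ∀ v → T (P v)
allBool-sound zero    P h []          = h
allBool-sound (suc n) P h (true ∷ v)  = allBool-sound n (P ∘ (true ∷_)) (proj₁ (Equivalence.to T-∧ h)) v
allBool-sound (suc n) P h (false ∷ v) = allBool-sound n (P ∘ (false ∷_)) (proj₂ (Equivalence.to T-∧ h)) v

-- Finite sums over ranges

sumFrom : (ℕ → ℕ) → ℕ → ℕ → ℕ
sumFrom f a zero    = 0
sumFrom f a (suc l) = f a + sumFrom f (suc a) l

InRange : ℕ → ℕ → ℕ → Set
InRange a l i = a ≤ i × i < a + l

InRange-suc : ∀ {a l i} → InRange (suc a) l i → InRange a (suc l) i
InRange-suc {a} {l} {i} (a<i , i<) = ≤-trans (n≤1+n a) a<i , subst (i <_) (sym (+-suc a l)) i<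

InRange-head : ∀ a l → InRange a (suc l) a
InRange-head a l = ≤-refl , m<m+n a z<s

InRange-tail : ∀ {a l i} → InRange a (suc l) i → a ≢ i → InRange (suc a) l i
InRange-tail {a} {l} {i} (a≤i , i<) a≢i = ≤∧≢⇒< a≤i a≢i , subst (i <_) (+-suc a l) i<

InRange-empty : ∀ a i → ¬ InRange a 0 i
InRange-empty a i (a≤i , i<a+0) = ≤⇒≯ a≤i (subst (i <_) (+-identityʳ a) i<a+0)

sumFrom-++ : ∀ f a l₁ l₂ → sumFrom f a (l₁ + l₂) ≡ sumFrom f a l₁ + sumFrom f (a + l₁) l₂
sumFrom-++ f a zero     l₂ rewrite +-identityʳ a = refl
sumFrom-++ f a (suc l₁) l₂ rewrite sumFrom-++ f (suc a) l₁ l₂ | +-suc a l₁ = sym (+-assoc (f a) _ _)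

sumFrom-cong : ∀ f g a l → (∀ i → InRange a l i → f i ≡ g i) → sumFrom f a l ≡ sumFrom g a l
sumFrom-cong f g a zero    h = refl
sumFrom-cong f g a (suc l) h =
  cong₂ _+_ (h a (InRange-head a l)) (sumFrom-cong f g (suc a) l (λ i r → h i (InRange-suc r)))

sumFrom-mono : ∀ f g a l → (∀ i → InRange a l i → f i ≤ g i) → sumFrom f a l ≤ sumFrom g a l
sumFrom-mono f g a zero    h = z≤n
sumFrom-mono f g a (suc l) h =
  +-mono-≤ (h a (InRange-head a l)) (sumFrom-mono f g (suc a) l (λ i r → h i (InRange-suc r)))

sumFrom-+ : ∀ f g a l → sumFrom (λ i → f i + g i) a l ≡ sumFrom f a l + sumFrom g a l
sumFrom-+ f g a zero    = refl
sumFrom-+ f g a (suc l) rewrite sumFrom-+ f g (suc a) l =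
  +-+-interchange (f a) (g a) (sumFrom f (suc a) l) (sumFrom g (suc a) l)
  where
  +-+-interchange : ∀ p q r s → p + q + (r + s) ≡ p + r + (q + s)
  +-+-interchange = solve-∀

sumFrom-*ˡ : ∀ c f a l → sumFrom (λ i → c * f i) a l ≡ c * sumFrom f a l
sumFrom-*ˡ c f a zero    = sym (*-zeroʳ c)
sumFrom-*ˡ c f a (suc l) rewrite sumFrom-*ˡ c f (suc a) l = sym (*-distribˡ-+ c (f a) _)

sumFrom-shift : ∀ f c a l → sumFrom (λ i → f (c + i)) a l ≡ sumFrom f (c + a) l
sumFrom-shift f c a zero    = refl
sumFrom-shift f c a (suc l) rewrite sumFrom-shift f c (suc a) l | +-suc c a = refl

sumFrom-const : ∀ c a l → sumFrom (λ _ → c) a l ≡ l * c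
sumFrom-const c a zero    = refl
sumFrom-const c a (suc l) = cong (c +_) (sumFrom-const c (suc a) l)

sumFrom-zero : ∀ f a l → (∀ i → InRange a l i → f i ≡ 0) → sumFrom f a l ≡ 0
sumFrom-zero f a l h = trans (sumFrom-cong f (λ _ → 0) a l h) (trans (sumFrom-const 0 a l) (*-zeroʳ l))

sumFrom-≥-term : ∀ f a l j → InRange a l j → f j ≤ sumFrom f a l
sumFrom-≥-term f a zero    j r = contradiction r (InRange-empty a j)
sumFrom-≥-term f a (suc l) j r with a ≟ j
... | yes refl = m≤m+n (f a) _
... | no a≢j   = ≤-trans (sumFrom-≥-term f (suc a) l j (InRange-tail r a≢j)) (m≤n+m _ (f a))

sumFrom-≥-two-terms : ∀ f a l j k → InRange a l j → InRange a l k → j ≢ k → f j + f k ≤ sumFrom f a l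
sumFrom-≥-two-terms f a zero    j k rj _ _ = contradiction rj (InRange-empty a j)
sumFrom-≥-two-terms f a (suc l) j k rj rk j≢k with a ≟ j | a ≟ k
... | yes refl | yes refl = contradiction refl j≢k
... | yes refl | no a≢k   = +-monoʳ-≤ (f a) (sumFrom-≥-term f (suc a) l k (InRange-tail rk a≢k))
... | no a≢j   | yes refl =
  subst (_≤ f a + sumFrom f (suc a) l) (+-comm (f a) (f j))
    (+-monoʳ-≤ (f a) (sumFrom-≥-term f (suc a) l j (InRange-tail rj a≢j)))
... | no a≢j   | no a≢k   =
  ≤-trans (sumFrom-≥-two-terms f (suc a) l j k (InRange-tail rj a≢j) (InRange-tail rk a≢k) j≢k)
          (m≤n+m _ (f a))

-- The bound ⌈2n/3⌉

⌈2n/3⌉-minimal : ∀ n d → 2 * n ≤ 3 * d → ⌈2n/3⌉ n ≤ d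
⌈2n/3⌉-minimal n d 2n≤3d = begin
    (2 * n + 2) / 3
  ≤⟨ /-monoˡ-≤ 3 (+-monoˡ-≤ 2 (≤-trans 2n≤3d (≤-reflexive (*-comm 3 d)))) ⟩
    (d * 3 + 2) / 3
  ≡⟨ +-distrib-/-∣ˡ 2 (divides d refl) ⟩
    d * 3 / 3 + 0
  ≡⟨ +-identityʳ _ ⟩
    d * 3 / 3
  ≡⟨ m*n/n≡m d 3 ⟩
    d ∎
  where open ≤-Reasoning

⌈2n/3⌉-+3 : ∀ n → ⌈2n/3⌉ (3 + n) ≡ 2 + ⌈2n/3⌉ n
⌈2n/3⌉-+3 n = begin
    (2 * (3 + n) + 2) / 3
  ≡⟨ cong (_/ 3) (regroup n) ⟩
    (2 * n + 2 + 6) / 3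
  ≡⟨ +-distrib-/-∣ʳ (2 * n + 2) (divides 2 refl) ⟩
    (2 * n + 2) / 3 + 2
  ≡⟨ +-comm _ 2 ⟩
    2 + (2 * n + 2) / 3 ∎
  where
  open ≡-Reasoning
  regroup : ∀ n → 2 * (3 + n) + 2 ≡ 2 * n + 2 + 6
  regroup = solve-∀

data Mod3 : Set where
  r₀ r₁ r₂ : Mod3

mod3 : ℕ → Mod3
mod3 zero    = r₀
mod3 (suc i) with mod3 i
... | r₀ = r₁
... | r₁ = r₂
... | r₂ = r₀

notTwoMod3 : ℕ → Bool
notTwoMod3 i with mod3 i
... | r₂ = false
... | _  = true

notTwoMod3-pred : ∀ i → notTwoMod3 (suc i) ≡ false → notTwoMod3 i ≡ true
notTwoMod3-pred i e with mod3 i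
... | r₁ = refl

notTwoMod3-+2 : ∀ i → notTwoMod3 i ≡ false → notTwoMod3 (2 + i) ≡ true
notTwoMod3-+2 i e with mod3 i
... | r₂ = refl

count-notTwoMod3-period : ∀ a → sumFrom (bit ∘ notTwoMod3) a 3 ≡ 2
count-notTwoMod3-period a with mod3 a
... | r₀ = refl
... | r₁ = refl
... | r₂ = refl

count-notTwoMod3 : ∀ t → 2 + sumFrom (bit ∘ notTwoMod3) 3 t ≡ ⌈2n/3⌉ (3 + t)
count-notTwoMod3 0             = refl
count-notTwoMod3 1             = refl
count-notTwoMod3 2             = refl
count-notTwoMod3 (suc (suc (suc t))) = begin
    2 + sumFrom f 3 (3 + t)
  ≡⟨ cong (λ l → 2 + sumFrom f 3 l) (+-comm 3 t) ⟩
    2 + sumFrom f 3 (t + 3)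
  ≡⟨ cong (2 +_) (sumFrom-++ f 3 t 3) ⟩
    2 + (sumFrom f 3 t + sumFrom f (3 + t) 3)
  ≡⟨ cong (λ c → 2 + (sumFrom f 3 t + c)) (count-notTwoMod3-period (3 + t)) ⟩
    2 + (sumFrom f 3 t + 2)
  ≡⟨ cong (2 +_) (+-comm (sumFrom f 3 t) 2) ⟩
    2 + (2 + sumFrom f 3 t)
  ≡⟨ cong (2 +_) (count-notTwoMod3 t) ⟩
    2 + ⌈2n/3⌉ (3 + t)
  ≡⟨ ⌈2n/3⌉-+3 (3 + t) ⟨
    ⌈2n/3⌉ (3 + (3 + t)) ∎
  where
  open ≡-Reasoning
  f = bit ∘ notTwoMod3

==-sym : ∀ {n} (x y : Fin n) → (x == y) ≡ (y == x)
==-sym x y with x ≟ᶠ y | y ≟ᶠ x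
... | yes _ | yes _ = refl
... | no _  | no _  = refl
... | yes x≡y | no y≢x = contradiction (sym x≡y) y≢x
... | no x≢y  | yes y≡x = contradiction (sym y≡x) x≢y

SymmetricGraph : Graph → Set
SymmetricGraph H = ∀ a b → adj H a b ≡ adj H b a

middle-symmetric : ∀ G → SymmetricGraph (middle G)
middle-symmetric G a b with splitAt (order G) a | splitAt (order G) b
... | inj₁ x | inj₁ y = refl
... | inj₁ x | inj₂ e = refl
... | inj₂ e | inj₁ y = refl
... | inj₂ e | inj₂ f =
  cong₂ (λ u v → not u ∧ v) (==-sym e f)
    (trans (∨-interchange (p₁ == q₁) (p₁ == q₂) (p₂ == q₁) (p₂ == q₂))
      (cong₂ _∨_ (cong₂ _∨_ (==-sym p₁ q₁) (==-sym p₂ q₁)) (cong₂ _∨_ (==-sym p₁ q₂) (==-sym p₂ q₂))))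
  where
  p₁ = proj₁ (lookup (edges G) e)
  p₂ = proj₂ (lookup (edges G) e)
  q₁ = proj₁ (lookup (edges G) f)
  q₂ = proj₂ (lookup (edges G) f)

module _ {H : Graph} {D : Subset (order H)} where

  walk-start∉ : ∀ {u v} → WalkOutside H D u v → u ∉ D
  walk-start∉ (here u∉D)     = u∉D
  walk-start∉ (step u∉D _ _) = u∉D

  walk-++ : ∀ {u w v} → WalkOutside H D u w → WalkOutside H D w v → WalkOutside H D u v
  walk-++ (here _)          q = q
  walk-++ (step u∉D uw p) q = step u∉D uw (walk-++ p q)

  walk-reverse : SymmetricGraph H → ∀ {u v} → WalkOutside H D u v → WalkOutside H D v u
  walk-reverse sym-H (here u∉D) = here u∉D
  walk-reverse sym-H (step {u} {w} u∉D uw p) =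
    walk-++ (walk-reverse sym-H p) (step (walk-start∉ p) (trans (sym-H w u) uw) (here u∉D))

  outerConnected-via : SymmetricGraph H → (c : Fin (order H)) →
    (∀ u → u ∉ D → WalkOutside H D u c) → OuterConnected H D
  outerConnected-via sym-H c reach u v u∉D v∉D =
    walk-++ (reach u u∉D) (walk-reverse sym-H (reach v v∉D))

-- Discharging along a cycle

-- s, r, v say whether the spoke v₀vᵢ, the rim edge vᵢvᵢ₊₁ and the vertex vᵢ of a block lie in D;
-- subscripts i, j, k are three consecutive blocks.
blockSize : Bool → Bool → Bool → ℕ
blockSize s r v = bit s + bit r + bit v

-- A potential on pairs of consecutive blocks; it enters `discharge-local` as τᵢ − τⱼ and cancels
-- when summed around the rim.
charge : Bool → Bool → Bool → Bool → Bool → Bool → ℕ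
charge sᵢ rᵢ vᵢ sⱼ rⱼ vⱼ =
  if not sᵢ ∧ not rᵢ ∧ not vᵢ then 2
  else if not sᵢ ∧ rᵢ ∧ not vᵢ ∧ not sⱼ ∧ not rⱼ ∧ not vⱼ then 1
  else 0

surplus : Bool → Bool → Bool → Bool → Bool → Bool → ℕ
surplus sᵢ rᵢ vᵢ sⱼ rⱼ vⱼ =
  if sᵢ then (if rᵢ ∨ vᵢ then 2 else 1)
  else (if rᵢ ∧ sⱼ ∧ not rⱼ ∧ not vⱼ then 1 else 0)

surplus-spoke : ∀ sᵢ rᵢ vᵢ sⱼ rⱼ vⱼ → sᵢ ≡ true → 1 ≤ surplus sᵢ rᵢ vᵢ sⱼ rⱼ vⱼ
surplus-spoke true true  vᵢ    sⱼ rⱼ vⱼ refl = s≤s z≤n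
surplus-spoke true false true  sⱼ rⱼ vⱼ refl = s≤s z≤n
surplus-spoke true false false sⱼ rⱼ vⱼ refl = s≤s z≤n

surplus-spoke₂ : ∀ sᵢ rᵢ vᵢ sⱼ rⱼ vⱼ → sᵢ ≡ true → (rᵢ ∨ vᵢ) ≡ true →
  2 ≤ surplus sᵢ rᵢ vᵢ sⱼ rⱼ vⱼ
surplus-spoke₂ true rᵢ vᵢ sⱼ rⱼ vⱼ refl e rewrite e = s≤s (s≤s z≤n)

surplus-rim : ∀ sᵢ rᵢ vᵢ sⱼ rⱼ vⱼ → rᵢ ≡ true → sⱼ ≡ true → rⱼ ≡ false → vⱼ ≡ false →
  1 ≤ surplus sᵢ rᵢ vᵢ sⱼ rⱼ vⱼ
surplus-rim true  true vᵢ true false false refl refl refl refl = surplus-spoke true true vᵢ true false false refl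
surplus-rim false true vᵢ true false false refl refl refl refl = s≤s z≤n

localRule : Vec Bool 9 → Bool
localRule (sᵢ ∷ rᵢ ∷ vᵢ ∷ sⱼ ∷ rⱼ ∷ vⱼ ∷ sₖ ∷ rₖ ∷ vₖ ∷ []) =
  not ((sⱼ ∨ rᵢ ∨ rⱼ) ∧ (vⱼ ∨ vₖ ∨ sⱼ ∨ sₖ ∨ rᵢ ∨ rₖ))
  ∨ (surplus sᵢ rᵢ vᵢ sⱼ rⱼ vⱼ + (2 + charge sⱼ rⱼ vⱼ sₖ rₖ vₖ)
       ≤ᵇ 3 * blockSize sᵢ rᵢ vᵢ + charge sᵢ rᵢ vᵢ sⱼ rⱼ vⱼ)

-- The premises say that vⱼ and vⱼvₖ have neighbours in D.
discharge-local : ∀ sᵢ rᵢ vᵢ sⱼ rⱼ vⱼ sₖ rₖ vₖ →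
  (sⱼ ∨ rᵢ ∨ rⱼ) ≡ true → (vⱼ ∨ vₖ ∨ sⱼ ∨ sₖ ∨ rᵢ ∨ rₖ) ≡ true →
  surplus sᵢ rᵢ vᵢ sⱼ rⱼ vⱼ + (2 + charge sⱼ rⱼ vⱼ sₖ rₖ vₖ)
    ≤ 3 * blockSize sᵢ rᵢ vᵢ + charge sᵢ rᵢ vᵢ sⱼ rⱼ vⱼ
discharge-local sᵢ rᵢ vᵢ sⱼ rⱼ vⱼ sₖ rₖ vₖ vⱼ-dominated rⱼ-dominated =
  ≤ᵇ⇒≤ _ _ (modusPonens (∧-intro vⱼ-dominated rⱼ-dominated)
    (allBool-sound 9 localRule tt (sᵢ ∷ rᵢ ∷ vᵢ ∷ sⱼ ∷ rⱼ ∷ vⱼ ∷ sₖ ∷ rₖ ∷ vₖ ∷ [])))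
  where
  modusPonens : ∀ {h c} → h ≡ true → T (not h ∨ c) → T c
  modusPonens refl t = t

InRim : ℕ → ℕ → Set
InRim m = InRange 1 m

record Cycle (m : ℕ) : Set where
  field
    next prev     : ℕ → ℕ
    next-inRim    : ∀ i → InRim m i → InRim m (next i)
    prev-inRim    : ∀ i → InRim m i → InRim m (prev i)
    next∘prev     : ∀ i → InRim m i → next (prev i) ≡ i
    prev∘next     : ∀ i → InRim m i → prev (next i) ≡ i
    prev-≢        : ∀ i → InRim m i → prev i ≢ i
    sumFrom-prev  : ∀ f → sumFrom (f ∘ prev) 1 m ≡ sumFrom f 1 m

module Discharging {m : ℕ} (C : Cycle m) where
  open Cycle C

  sumFrom-next : ∀ f → sumFrom (f ∘ next) 1 m ≡ sumFrom f 1 m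
  sumFrom-next f = trans (sym (sumFrom-prev (f ∘ next)))
    (sumFrom-cong (f ∘ next ∘ prev) f 1 m (λ i r → cong f (next∘prev i r)))

  module _ (spoke rim vtx : ℕ → Bool) (hub : Bool)
    (vtx-dominated   : ∀ i → InRim m i → (spoke i ∨ rim (prev i) ∨ rim i) ≡ true)
    (rim-dominated   : ∀ i → InRim m i →
                       (vtx i ∨ vtx (next i) ∨ spoke i ∨ spoke (next i) ∨ rim (prev i) ∨ rim (next i)) ≡ true)
    (hub-dominated   : Σ ℕ λ j → InRim m j × spoke j ≡ true)
    (spoke-dominated : ∀ j → InRim m j →
                       hub ≡ true ⊎ vtx j ≡ true ⊎ (Σ ℕ λ j′ → InRim m j′ × j′ ≢ j × spoke j′ ≡ true)
                       ⊎ rim (prev j) ≡ true ⊎ rim j ≡ true)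
    where

    size : ℕ → ℕ
    size i = blockSize (spoke i) (rim i) (vtx i)

    τ : ℕ → ℕ
    τ i = charge (spoke i) (rim i) (vtx i) (spoke (next i)) (rim (next i)) (vtx (next i))

    ν : ℕ → ℕ
    ν i = surplus (spoke i) (rim i) (vtx i) (spoke (next i)) (rim (next i)) (vtx (next i))

    local-bound : ∀ i → InRim m i → ν i + (2 + τ (next i)) ≤ 3 * size i + τ i
    local-bound i r = discharge-local (spoke i) (rim i) (vtx i) (spoke j) (rim j) (vtx j)
                                (spoke (next j)) (rim (next j)) (vtx (next j))
      (subst (λ w → (spoke j ∨ rim w ∨ rim j) ≡ true) (prev∘next i r) (vtx-dominated j rj))
      (subst (λ w → (vtx j ∨ vtx (next j) ∨ spoke j ∨ spoke (next j) ∨ rim w ∨ rim (next j)) ≡ true)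
             (prev∘next i r) (rim-dominated j rj))
      where
      j = next i
      rj = next-inRim i r

    summed-bound : sumFrom ν 1 m + m * 2 ≤ 3 * sumFrom size 1 m
    summed-bound = +-cancelʳ-≤ (sumFrom τ 1 m) _ _ (begin
        sumFrom ν 1 m + m * 2 + sumFrom τ 1 m
      ≡⟨ +-assoc (sumFrom ν 1 m) _ _ ⟩
        sumFrom ν 1 m + (m * 2 + sumFrom τ 1 m)
      ≡⟨ cong₂ (λ a b → sumFrom ν 1 m + (a + b)) (sumFrom-const 2 1 m) (sumFrom-next τ) ⟨
        sumFrom ν 1 m + (sumFrom (λ _ → 2) 1 m + sumFrom (τ ∘ next) 1 m)
      ≡⟨ cong (sumFrom ν 1 m +_) (sumFrom-+ (λ _ → 2) (τ ∘ next) 1 m) ⟨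
        sumFrom ν 1 m + sumFrom (λ i → 2 + τ (next i)) 1 m
      ≡⟨ sumFrom-+ ν (λ i → 2 + τ (next i)) 1 m ⟨
        sumFrom (λ i → ν i + (2 + τ (next i))) 1 m
      ≤⟨ sumFrom-mono _ (λ i → 3 * size i + τ i) 1 m local-bound ⟩
        sumFrom (λ i → 3 * size i + τ i) 1 m
      ≡⟨ sumFrom-+ (λ i → 3 * size i) τ 1 m ⟩
        sumFrom (λ i → 3 * size i) 1 m + sumFrom τ 1 m
      ≡⟨ cong (_+ sumFrom τ 1 m) (sumFrom-*ˡ 3 size 1 m) ⟩
        3 * sumFrom size 1 m + sumFrom τ 1 m ∎)
      where open ≤-Reasoning

    ν-spoke : ∀ i → spoke i ≡ true → 1 ≤ ν i
    ν-spoke i = surplus-spoke (spoke i) (rim i) (vtx i) (spoke (next i)) (rim (next i)) (vtx (next i))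

    ν-spoke₂ : ∀ i → spoke i ≡ true → (rim i ∨ vtx i) ≡ true → 2 ≤ ν i
    ν-spoke₂ i = surplus-spoke₂ (spoke i) (rim i) (vtx i) (spoke (next i)) (rim (next i)) (vtx (next i))

    ν-rim : ∀ i → rim i ≡ true → spoke (next i) ≡ true → rim (next i) ≡ false → vtx (next i) ≡ false → 1 ≤ ν i
    ν-rim i = surplus-rim (spoke i) (rim i) (vtx i) (spoke (next i)) (rim (next i)) (vtx (next i))

    slack : (Σ ℕ λ j → InRim m j × spoke j ≡ true) → hub ≡ false → 2 ≤ sumFrom ν 1 m
    slack (j , rj , sⱼ) hub∉D with rim j ∨ vtx j in rv
    ... | true = ≤-trans (ν-spoke₂ j sⱼ rv) (sumFrom-≥-term ν 1 m j rj)
    ... | false with spoke-dominated j rj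
    ... | inj₁ hub∈D = contradiction hub∈D (λ e → true≢false e hub∉D)
    ... | inj₂ (inj₁ vⱼ) = contradiction vⱼ (λ e → true≢false e (∨-falseʳ rv))
    ... | inj₂ (inj₂ (inj₂ (inj₂ rⱼ))) = contradiction rⱼ (λ e → true≢false e (∨-falseˡ rv))
    ... | inj₂ (inj₂ (inj₁ (j′ , rj′ , j′≢j , sⱼ′))) =
      ≤-trans (+-mono-≤ (ν-spoke j sⱼ) (ν-spoke j′ sⱼ′))
              (sumFrom-≥-two-terms ν 1 m j j′ rj rj′ (j′≢j ∘ sym))
    ... | inj₂ (inj₂ (inj₂ (inj₁ rₚ))) =
      ≤-trans (+-mono-≤ (ν-spoke j sⱼ)
                        (ν-rim p rₚ (at-next spoke sⱼ) (at-next rim (∨-falseˡ rv)) (at-next vtx (∨-falseʳ rv))))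
              (sumFrom-≥-two-terms ν 1 m j p rj (prev-inRim j rj) (prev-≢ j rj ∘ sym))
      where
      p = prev j
      at-next : ∀ {b} (f : ℕ → Bool) → f j ≡ b → f (next p) ≡ b
      at-next f e = trans (cong f (next∘prev j rj)) e

    size-bound : 2 * m + 2 ≤ 3 * (bit hub + sumFrom size 1 m)
    size-bound = bound hub refl
      where
      bound : ∀ b → hub ≡ b → 2 * m + 2 ≤ 3 * (bit b + sumFrom size 1 m)
      bound true _ = begin
          2 * m + 2
        ≤⟨ +-monoʳ-≤ (2 * m) (n≤1+n 2) ⟩
          2 * m + 3
        ≡⟨ +-comm (2 * m) 3 ⟩
          3 + 2 * m
        ≤⟨ +-monoʳ-≤ 3 (≤-trans (≤-reflexive (*-comm 2 m)) (≤-trans (m≤n+m (m * 2) (sumFrom ν 1 m)) summed-bound)) ⟩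
          3 + 3 * sumFrom size 1 m
        ≡⟨ *-distribˡ-+ 3 1 (sumFrom size 1 m) ⟨
          3 * (1 + sumFrom size 1 m) ∎
        where open ≤-Reasoning
      bound false eq = begin
          2 * m + 2
        ≡⟨ cong (_+ 2) (*-comm 2 m) ⟩
          m * 2 + 2
        ≤⟨ +-monoʳ-≤ (m * 2) (slack hub-dominated eq) ⟩
          m * 2 + sumFrom ν 1 m
        ≡⟨ +-comm (m * 2) _ ⟩
          sumFrom ν 1 m + m * 2
        ≤⟨ summed-bound ⟩
          3 * sumFrom size 1 m ∎
        where open ≤-Reasoning

-- The edge list of the wheel

range : ℕ → ℕ → List ℕ
range a zero    = []
range a (suc l) = a ∷ range (suc a) l

range-++ : ∀ a l₁ l₂ → range a (l₁ + l₂) ≡ range a l₁ ++ range (a + l₁) l₂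
range-++ a zero     l₂ rewrite +-identityʳ a = refl
range-++ a (suc l₁) l₂ rewrite range-++ (suc a) l₁ l₂ | +-suc a l₁ = refl

range-snoc : ∀ a l → range a (suc l) ≡ range a l ++ (a + l) ∷ []
range-snoc a l = trans (cong (range a) (+-comm 1 l)) (range-++ a l 1)

length-range : ∀ a l → length (range a l) ≡ l
length-range a zero    = refl
length-range a (suc l) = cong suc (length-range (suc a) l)

map-suc-range : ∀ a l → map suc (range a l) ≡ range (suc a) l
map-suc-range a zero    = refl
map-suc-range a (suc l) = cong (suc a ∷_) (map-suc-range (suc a) l)

map-toℕ-allFin : ∀ n → map toℕ (allFin n) ≡ range 0 n
map-toℕ-allFin zero    = refl
map-toℕ-allFin (suc n) = cong (0 ∷_) (begin
    map toℕ (Data.List.tabulate {n = n} Fin.suc)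
  ≡⟨ map-tabulate Fin.suc toℕ ⟩
    Data.List.tabulate (suc ∘ toℕ)
  ≡⟨ map-tabulate toℕ suc ⟨
    map suc (Data.List.tabulate toℕ)
  ≡⟨ cong (map suc) (trans (sym (map-tabulate (λ i → i) toℕ)) (map-toℕ-allFin n)) ⟩
    map suc (range 0 n)
  ≡⟨ map-suc-range 0 n ⟩
    range 1 n ∎)
  where open ≡-Reasoning

filterᵇ-all : ∀ (q : ℕ → Bool) a l → (∀ i → InRange a l i → q i ≡ true) → filterᵇ q (range a l) ≡ range a l
filterᵇ-all q a zero    h = refl
filterᵇ-all q a (suc l) h with q a | h a (InRange-head a l)
... | true | _ = cong (a ∷_) (filterᵇ-all q (suc a) l (λ i r → h i (InRange-suc r)))

filterᵇ-none : ∀ (q : ℕ → Bool) a l → (∀ i → InRange a l i → q i ≡ false) → filterᵇ q (range a l) ≡ []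
filterᵇ-none q a zero    h = refl
filterᵇ-none q a (suc l) h with q a | h a (InRange-head a l)
... | false | _ = filterᵇ-none q (suc a) l (λ i r → h i (InRange-suc r))

filterᵇ-accept : ∀ (q : ℕ → Bool) x xs → q x ≡ true → filterᵇ q (x ∷ xs) ≡ x ∷ filterᵇ q xs
filterᵇ-accept q x xs e with q x
... | true = refl

map-filterᵇ : ∀ {A B : Set} (g : A → B) (P : A → Bool) (Q : B → Bool) → (∀ x → P x ≡ Q (g x)) →
  ∀ xs → map g (filterᵇ P xs) ≡ filterᵇ Q (map g xs)
map-filterᵇ g P Q h [] = refl
map-filterᵇ g P Q h (x ∷ xs) with P x | Q (g x) | h x
... | true  | true  | _ = cong (g x ∷_) (map-filterᵇ g P Q h xs)
... | false | false | _ = map-filterᵇ g P Q h xs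

filterᵇ-map-pair : ∀ {A B : Set} (Q : A × B → Bool) i ys →
  filterᵇ Q (map (i ,_) ys) ≡ map (i ,_) (filterᵇ (λ j → Q (i , j)) ys)
filterᵇ-map-pair Q i ys = sym (map-filterᵇ (i ,_) (λ j → Q (i , j)) Q (λ _ → refl) ys)

map-cartesianProduct : ∀ {A B C D : Set} (f : A → C) (g : B → D) xs ys →
  map (λ p → f (proj₁ p) , g (proj₂ p)) (cartesianProduct xs ys) ≡ cartesianProduct (map f xs) (map g ys)
map-cartesianProduct f g []       ys = refl
map-cartesianProduct f g (x ∷ xs) ys =
  trans (map-++ _ (map (x ,_) ys) (cartesianProduct xs ys))
        (cong₂ _++_ (map-row ys) (map-cartesianProduct f g xs ys))
  where
  map-row : ∀ zs → map (λ p → f (proj₁ p) , g (proj₂ p)) (map (x ,_) zs) ≡ map (f x ,_) (map g zs)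
  map-row []       = refl
  map-row (z ∷ zs) = cong (_ ∷_) (map-row zs)

-- wheelAdj (suc m) on toℕ of its arguments, definitionally.
wheelAdjℕ : ℕ → ℕ → ℕ → Bool
wheelAdjℕ m i j = hub ∨ rim
  where
  hub = ((i ≡ᵇ 0) ∧ not (j ≡ᵇ 0)) ∨ (not (i ≡ᵇ 0) ∧ (j ≡ᵇ 0))
  consecutive : ℕ → ℕ → Bool
  consecutive x y = (suc x ≡ᵇ y) ∨ (suc y ≡ᵇ x)
  rim = not (i ≡ᵇ 0) ∧ not (j ≡ᵇ 0)
        ∧ (consecutive i j ∨ ((i ≡ᵇ 1) ∧ (j ≡ᵇ m)) ∨ ((j ≡ᵇ 1) ∧ (i ≡ᵇ m)))

isEdgeℕ : ℕ → ℕ × ℕ → Bool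
isEdgeℕ m (i , j) = (i <ᵇ j) ∧ wheelAdjℕ m i j

toℕ² : ∀ {k} → Fin k × Fin k → ℕ × ℕ
toℕ² (x , y) = toℕ x , toℕ y

isEdgeᵇ : (l a b c d e f g h : Bool) → Bool
isEdgeᵇ l a b c d e f g h = l ∧ (((a ∧ not b) ∨ (not a ∧ b)) ∨ (not a ∧ not b ∧ ((c ∨ d) ∨ (e ∧ f) ∨ (g ∧ h))))

isEdgeℕ-eval : ∀ m i j {l a b c d e f g h} →
  (i <ᵇ j) ≡ l → (i ≡ᵇ 0) ≡ a → (j ≡ᵇ 0) ≡ b → (suc i ≡ᵇ j) ≡ c → (suc j ≡ᵇ i) ≡ d →
  (i ≡ᵇ 1) ≡ e → (j ≡ᵇ m) ≡ f → (j ≡ᵇ 1) ≡ g → (i ≡ᵇ m) ≡ h → isEdgeℕ m (i , j) ≡ isEdgeᵇ l a b c d e f g h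
isEdgeℕ-eval m i j refl refl refl refl refl refl refl refl refl = refl

wheelEdgesℕ : ℕ → List (ℕ × ℕ)
wheelEdgesℕ m = map (0 ,_) (range 1 m) ++ (1 , 2) ∷ (1 , m) ∷ map (λ i → (i , suc i)) (range 2 (m ∸ 2))

edgesFrom-hub : ∀ m → filterᵇ (λ j → isEdgeℕ m (0 , j)) (range 0 (suc m)) ≡ range 1 m
edgesFrom-hub m = filterᵇ-all _ 1 m h
  where
  h : ∀ i → InRange 1 m i → isEdgeℕ m (0 , i) ≡ true
  h (suc i) _ = refl

edgesFrom-1 : ∀ k → filterᵇ (λ j → isEdgeℕ (4 + k) (1 , j)) (range 0 (5 + k)) ≡ 2 ∷ (4 + k) ∷ []
edgesFrom-1 k = begin
    filterᵇ q (0 ∷ 1 ∷ 2 ∷ range 3 (2 + k))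
  ≡⟨ cong (λ z → filterᵇ q (0 ∷ 1 ∷ 2 ∷ z)) (range-snoc 3 (1 + k)) ⟩
    2 ∷ filterᵇ q (range 3 (1 + k) ++ (4 + k) ∷ [])
  ≡⟨ cong (2 ∷_) (filter-++ (T? ∘ q) (range 3 (1 + k)) _) ⟩
    2 ∷ (filterᵇ q (range 3 (1 + k)) ++ filterᵇ q ((4 + k) ∷ []))
  ≡⟨ cong (λ z → 2 ∷ (z ++ filterᵇ q ((4 + k) ∷ []))) (filterᵇ-none q 3 (1 + k) far) ⟩
    2 ∷ filterᵇ q ((4 + k) ∷ [])
  ≡⟨ cong (2 ∷_) (filterᵇ-accept q (4 + k) [] last) ⟩
    2 ∷ (4 + k) ∷ [] ∎
  where
  open ≡-Reasoning
  q = λ j → isEdgeℕ (4 + k) (1 , j)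
  far : ∀ i → InRange 3 (1 + k) i → q i ≡ false
  far (suc (suc (suc i))) (s≤s (s≤s (s≤s _)) , lt) =
    isEdgeℕ-eval (4 + k) 1 (3 + i) refl refl refl refl refl refl (<⇒≡ᵇ≡false lt) refl refl
  last : q (4 + k) ≡ true
  last = isEdgeℕ-eval (4 + k) 1 (4 + k) refl refl refl refl refl refl (≡ᵇ-refl (4 + k)) refl refl

edgesFrom-inner : ∀ m i → 2 ≤ i → i < m → filterᵇ (λ j → isEdgeℕ m (i , j)) (range 0 (suc m)) ≡ suc i ∷ []
edgesFrom-inner m i@(suc (suc _)) (s≤s (s≤s _)) i<m = begin
    filterᵇ q (range 0 (suc m))
  ≡⟨ cong (filterᵇ q) split ⟩
    filterᵇ q (range 0 (suc i) ++ suc i ∷ range (2 + i) (m ∸ suc i))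
  ≡⟨ filter-++ (T? ∘ q) (range 0 (suc i)) _ ⟩
    filterᵇ q (range 0 (suc i)) ++ filterᵇ q (suc i ∷ range (2 + i) (m ∸ suc i))
  ≡⟨ cong (_++ filterᵇ q (suc i ∷ range (2 + i) (m ∸ suc i))) (filterᵇ-none q 0 (suc i) below) ⟩
    filterᵇ q (suc i ∷ range (2 + i) (m ∸ suc i))
  ≡⟨ filterᵇ-accept q (suc i) _ successor ⟩
    suc i ∷ filterᵇ q (range (2 + i) (m ∸ suc i))
  ≡⟨ cong (suc i ∷_) (filterᵇ-none q (2 + i) (m ∸ suc i) above) ⟩
    suc i ∷ [] ∎
  where
  open ≡-Reasoning
  q = λ j → isEdgeℕ m (i , j)
  split : range 0 (suc m) ≡ range 0 (suc i) ++ suc i ∷ range (2 + i) (m ∸ suc i)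
  split = trans (cong (range 0) (sym (trans (+-suc (suc i) (m ∸ suc i)) (cong suc (m+[n∸m]≡n i<m)))))
                (range-++ 0 (suc i) (suc (m ∸ suc i)))
  below : ∀ j → InRange 0 (suc i) j → q j ≡ false
  below j (_ , s≤s j≤i) = isEdgeℕ-eval m i j (≥⇒<ᵇ≡false i j j≤i) refl refl refl refl refl refl refl refl
  successor : q (suc i) ≡ true
  successor = isEdgeℕ-eval m i (suc i) (<⇒<ᵇ≡true i (suc i) ≤-refl) refl refl (≡ᵇ-refl (suc i))
                (>⇒≡ᵇ≡false (<-trans (n<1+n i) (n<1+n (suc i)))) refl refl refl refl
  above : ∀ j → InRange (2 + i) (m ∸ suc i) j → q j ≡ false
  above (suc zero)      (s≤s () , _)
  above (suc (suc j)) (le , _) =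
    isEdgeℕ-eval m i (suc (suc j)) (<⇒<ᵇ≡true i (2 + j) (≤-trans (n≤1+n _) le)) refl refl
      (<⇒≡ᵇ≡false le) (>⇒≡ᵇ≡false (≤-trans (≤-trans (n≤1+n (suc i)) le) (n≤1+n _))) refl refl refl refl

edgesFrom-last : ∀ m → filterᵇ (λ j → isEdgeℕ m (m , j)) (range 0 (suc m)) ≡ []
edgesFrom-last m = filterᵇ-none _ 0 (suc m) below
  where
  below : ∀ j → InRange 0 (suc m) j → isEdgeℕ m (m , j) ≡ false
  below j (_ , s≤s j≤m) = isEdgeℕ-eval m m j (≥⇒<ᵇ≡false m j j≤m) refl refl refl refl refl refl refl refl

edgesFrom-inners : ∀ m a l → 2 ≤ a → a + l ≤ m →
  filterᵇ (isEdgeℕ m) (cartesianProduct (range a l) (range 0 (suc m))) ≡ map (λ i → (i , suc i)) (range a l)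
edgesFrom-inners m a zero    _   _ = refl
edgesFrom-inners m a (suc l) 2≤a a+l<m = begin
    filterᵇ (isEdgeℕ m) (map (a ,_) R ++ cartesianProduct (range (suc a) l) R)
  ≡⟨ filter-++ (T? ∘ isEdgeℕ m) (map (a ,_) R) _ ⟩
    filterᵇ (isEdgeℕ m) (map (a ,_) R) ++ filterᵇ (isEdgeℕ m) (cartesianProduct (range (suc a) l) R)
  ≡⟨ cong₂ _++_ (trans (filterᵇ-map-pair (isEdgeℕ m) a R) (cong (map (a ,_)) (edgesFrom-inner m a 2≤a a<m)))
                (edgesFrom-inners m (suc a) l (≤-trans 2≤a (n≤1+n a)) (subst (_≤ m) (+-suc a l) a+l<m)) ⟩
    (a , suc a) ∷ map (λ i → (i , suc i)) (range (suc a) l) ∎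
  where
  open ≡-Reasoning
  R = range 0 (suc m)
  a<m : a < m
  a<m = ≤-trans (s≤s (m≤m+n a l)) (subst (_≤ m) (+-suc a l) a+l<m)

filter-isEdgeℕ : ∀ k → filterᵇ (isEdgeℕ (4 + k)) (cartesianProduct (range 0 (5 + k)) (range 0 (5 + k)))
                       ≡ wheelEdgesℕ (4 + k)
filter-isEdgeℕ k = begin
    filterᵇ Q (map (0 ,_) R ++ map (1 ,_) R ++ cartesianProduct (range 2 (3 + k)) R)
  ≡⟨ filter-++ (T? ∘ Q) (map (0 ,_) R) _ ⟩
    filterᵇ Q (map (0 ,_) R) ++ filterᵇ Q (map (1 ,_) R ++ cartesianProduct (range 2 (3 + k)) R)
  ≡⟨ cong (filterᵇ Q (map (0 ,_) R) ++_) (filter-++ (T? ∘ Q) (map (1 ,_) R) _) ⟩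
    filterᵇ Q (map (0 ,_) R) ++ filterᵇ Q (map (1 ,_) R) ++ filterᵇ Q (cartesianProduct (range 2 (3 + k)) R)
  ≡⟨ cong₂ (λ x y → x ++ y ++ filterᵇ Q (cartesianProduct (range 2 (3 + k)) R))
       (trans (filterᵇ-map-pair Q 0 R) (cong (map (0 ,_)) (edgesFrom-hub m)))
       (trans (filterᵇ-map-pair Q 1 R) (cong (map (1 ,_)) (edgesFrom-1 k))) ⟩
    map (0 ,_) (range 1 m) ++ (1 , 2) ∷ (1 , m) ∷ filterᵇ Q (cartesianProduct (range 2 (3 + k)) R)
  ≡⟨ cong (λ z → map (0 ,_) (range 1 m) ++ (1 , 2) ∷ (1 , m) ∷ z) rest ⟩
    wheelEdgesℕ m ∎
  where
  open ≡-Reasoning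
  m = 4 + k
  R = range 0 (5 + k)
  Q = isEdgeℕ m
  rest : filterᵇ Q (cartesianProduct (range 2 (3 + k)) R) ≡ map (λ i → (i , suc i)) (range 2 (2 + k))
  rest = begin
      filterᵇ Q (cartesianProduct (range 2 (3 + k)) R)
    ≡⟨ cong (λ z → filterᵇ Q (cartesianProduct z R)) (range-snoc 2 (2 + k)) ⟩
      filterᵇ Q (cartesianProduct (range 2 (2 + k) ++ m ∷ []) R)
    ≡⟨ cong (filterᵇ Q) (cartesianProductWith-distribʳ-++ _,_ (range 2 (2 + k)) (m ∷ []) R) ⟩
      filterᵇ Q (cartesianProduct (range 2 (2 + k)) R ++ cartesianProduct (m ∷ []) R)
    ≡⟨ filter-++ (T? ∘ Q) (cartesianProduct (range 2 (2 + k)) R) _ ⟩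
      filterᵇ Q (cartesianProduct (range 2 (2 + k)) R) ++ filterᵇ Q (map (m ,_) R ++ [])
    ≡⟨ cong₂ _++_ (edgesFrom-inners m 2 (2 + k) ≤-refl ≤-refl)
         (trans (cong (filterᵇ Q) (++-identityʳ (map (m ,_) R)))
                (trans (filterᵇ-map-pair Q m R) (cong (map (m ,_)) (edgesFrom-last m)))) ⟩
      map (λ i → (i , suc i)) (range 2 (2 + k)) ++ []
    ≡⟨ ++-identityʳ _ ⟩
      map (λ i → (i , suc i)) (range 2 (2 + k)) ∎

length-map-range : ∀ (f : ℕ → ℕ × ℕ) a l → length (map f (range a l)) ≡ l
length-map-range f a l = trans (length-map f (range a l)) (length-range a l)

length-wheelEdgesℕ : ∀ k → length (wheelEdgesℕ (4 + k)) ≡ (4 + k) + (4 + k)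
length-wheelEdgesℕ k =
  trans (length-++ (map (0 ,_) (range 1 (4 + k))) {(1 , 2) ∷ (1 , 4 + k) ∷ map (λ i → (i , suc i)) (range 2 (2 + k))})
        (cong₂ (λ x y → x + (2 + y)) (length-map-range (0 ,_) 1 (4 + k)) (length-map-range (λ i → (i , suc i)) 2 (2 + k)))

lookupℕ : List (ℕ × ℕ) → ℕ → ℕ × ℕ
lookupℕ []       k       = (0 , 0)
lookupℕ (x ∷ xs) zero    = x
lookupℕ (x ∷ xs) (suc k) = lookupℕ xs k

lookupℕ-map : ∀ {A : Set} (f : A → ℕ × ℕ) (xs : List A) ys → map f xs ≡ ys →
  ∀ (e : Fin (length xs)) → f (lookup xs e) ≡ lookupℕ ys (toℕ e)
lookupℕ-map f (x ∷ xs) _ refl Fin.zero    = refl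
lookupℕ-map f (x ∷ xs) _ refl (Fin.suc e) = lookupℕ-map f xs _ refl e

lookupℕ-++ˡ : ∀ xs ys k → k < length xs → lookupℕ (xs ++ ys) k ≡ lookupℕ xs k
lookupℕ-++ˡ (x ∷ xs) ys zero    _         = refl
lookupℕ-++ˡ (x ∷ xs) ys (suc k) (s≤s k<l) = lookupℕ-++ˡ xs ys k k<l

lookupℕ-++ʳ : ∀ xs ys t → lookupℕ (xs ++ ys) (length xs + t) ≡ lookupℕ ys t
lookupℕ-++ʳ []       ys t = refl
lookupℕ-++ʳ (x ∷ xs) ys t = lookupℕ-++ʳ xs ys t

lookupℕ-map-range : ∀ (f : ℕ → ℕ × ℕ) a l t → t < l → lookupℕ (map f (range a l)) t ≡ f (a + t)
lookupℕ-map-range f a (suc l) zero    _         = cong f (sym (+-identityʳ a))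
lookupℕ-map-range f a (suc l) (suc t) (s≤s t<l) = trans (lookupℕ-map-range f (suc a) l t t<l) (cong f (sym (+-suc a t)))

==-toℕ : ∀ {n} (x y : Fin n) → (x == y) ≡ (toℕ x ≡ᵇ toℕ y)
==-toℕ x y with x ≟ᶠ y
... | yes refl = sym (≡ᵇ-refl (toℕ x))
... | no x≢y   = sym (≢⇒≡ᵇ≡false _ _ (x≢y ∘ toℕ-injective))

-- The middle graph of the wheel of order 5 + k, with vertices numbered in ℕ: v₀, …, vₘ are 0 … m,
-- and the edge with index t is n + t.
module Wheel (k : ℕ) where

  m n N : ℕ
  m = 4 + k
  n = suc m
  N = n + (m + m)

  E : List (Fin n × Fin n)
  E = edges (wheel n)

  map-toℕ²-edges : map toℕ² E ≡ wheelEdgesℕ m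
  map-toℕ²-edges = begin
      map toℕ² E
    ≡⟨ map-filterᵇ toℕ² _ (isEdgeℕ m) (λ _ → refl) (cartesianProduct (allFin n) (allFin n)) ⟩
      filterᵇ (isEdgeℕ m) (map toℕ² (cartesianProduct (allFin n) (allFin n)))
    ≡⟨ cong (filterᵇ (isEdgeℕ m)) (trans (map-cartesianProduct toℕ toℕ (allFin n) (allFin n))
                                         (cong₂ cartesianProduct (map-toℕ-allFin n) (map-toℕ-allFin n))) ⟩
      filterᵇ (isEdgeℕ m) (cartesianProduct (range 0 n) (range 0 n))
    ≡⟨ filter-isEdgeℕ k ⟩
      wheelEdgesℕ m ∎
    where open ≡-Reasoning

  length-edges : length E ≡ m + m
  length-edges = begin
      length E
    ≡⟨ length-map toℕ² E ⟨
      length (map toℕ² E)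
    ≡⟨ cong length map-toℕ²-edges ⟩
      length (wheelEdgesℕ m)
    ≡⟨ length-wheelEdgesℕ k ⟩
      m + m ∎
    where open ≡-Reasoning

  order≡N : order (middle (wheel n)) ≡ N
  order≡N = cong (n +_) length-edges

  -- Opaque, so that unification treats `ends t` as rigid instead of unfolding the edge list.
  opaque
    ends : ℕ → ℕ × ℕ
    ends = lookupℕ (wheelEdgesℕ m)

    ends-lookup : ∀ e → toℕ² (lookup E e) ≡ ends (toℕ e)
    ends-lookup = lookupℕ-map toℕ² E (wheelEdgesℕ m) map-toℕ²-edges

  incident : ℕ → ℕ → Bool
  incident x t = (x ≡ᵇ proj₁ (ends t)) ∨ (x ≡ᵇ proj₂ (ends t))

  incident-ends-inv : ∀ {t a b} x → ends t ≡ (a , b) → incident x t ≡ true → x ≡ a ⊎ x ≡ b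
  incident-ends-inv x e x∈t = ∨-≡ᵇ-elim x _ _ (subst (λ p → ((x ≡ᵇ proj₁ p) ∨ (x ≡ᵇ proj₂ p)) ≡ true) e x∈t)

  edgesMeet : ℕ → ℕ → Bool
  edgesMeet t s = not (t ≡ᵇ s) ∧ (incident (proj₁ (ends t)) s ∨ incident (proj₂ (ends t)) s)

  adjᵇ : Bool → Bool → ℕ → ℕ → Bool
  adjᵇ true  true  i j = false
  adjᵇ true  false i j = incident i (j ∸ n)
  adjᵇ false true  i j = incident j (i ∸ n)
  adjᵇ false false i j = edgesMeet (i ∸ n) (j ∸ n)

  adjℕ : ℕ → ℕ → Bool
  adjℕ i j = adjᵇ (i <ᵇ n) (j <ᵇ n) i j

  adjℕ-eval : ∀ i j {p q} → (i <ᵇ n) ≡ p → (j <ᵇ n) ≡ q → adjℕ i j ≡ adjᵇ p q i j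
  adjℕ-eval i j refl refl = refl

  incident-toℕ : ∀ (x : Fin n) (e : Fin (length E)) →
    ((x == proj₁ (lookup E e)) ∨ (x == proj₂ (lookup E e))) ≡ incident (toℕ x) (toℕ e)
  incident-toℕ x e =
    cong₂ _∨_ (trans (==-toℕ x _) (cong (toℕ x ≡ᵇ_) (cong proj₁ (ends-lookup e))))
              (trans (==-toℕ x _) (cong (toℕ x ≡ᵇ_) (cong proj₂ (ends-lookup e))))

  edgesMeet-toℕ : ∀ (e f : Fin (length E)) →
    (not (e == f) ∧ (((proj₁ (lookup E e) == proj₁ (lookup E f)) ∨ (proj₁ (lookup E e) == proj₂ (lookup E f)))
                   ∨ ((proj₂ (lookup E e) == proj₁ (lookup E f)) ∨ (proj₂ (lookup E e) == proj₂ (lookup E f)))))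
    ≡ edgesMeet (toℕ e) (toℕ f)
  edgesMeet-toℕ e f = cong₂ (λ u v → not u ∧ v) (==-toℕ e f)
    (cong₂ _∨_ (trans (incident-toℕ (proj₁ (lookup E e)) f) (cong (λ z → incident z (toℕ f)) (cong proj₁ (ends-lookup e))))
               (trans (incident-toℕ (proj₂ (lookup E e)) f) (cong (λ z → incident z (toℕ f)) (cong proj₂ (ends-lookup e)))))

  private
    L = length E

    toℕ-inj₁ : ∀ {a : Fin (n + L)} {x} → splitAt n a ≡ inj₁ x → toℕ a ≡ toℕ x
    toℕ-inj₁ {a} {x} eq = trans (cong toℕ (sym (splitAt⁻¹-↑ˡ eq))) (toℕ-↑ˡ x L)

    toℕ-inj₂ : ∀ {a : Fin (n + L)} {e} → splitAt n a ≡ inj₂ e → toℕ a ≡ n + toℕ e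
    toℕ-inj₂ {a} {e} eq = trans (cong toℕ (sym (splitAt⁻¹-↑ʳ eq))) (toℕ-↑ʳ n e)

    vertex<ᵇ : ∀ {a : Fin (n + L)} {x} → splitAt n a ≡ inj₁ x → (toℕ a <ᵇ n) ≡ true
    vertex<ᵇ {a} {x} eq = trans (cong (_<ᵇ n) (toℕ-inj₁ {a} eq)) (<⇒<ᵇ≡true _ _ (toℕ<n x))

    edge<ᵇ : ∀ {a : Fin (n + L)} {e} → splitAt n a ≡ inj₂ e → (toℕ a <ᵇ n) ≡ false
    edge<ᵇ {a} eq = trans (cong (_<ᵇ n) (toℕ-inj₂ {a} eq)) (≥⇒<ᵇ≡false _ _ (m≤m+n n _))

    edge∸ : ∀ {a : Fin (n + L)} {e} → splitAt n a ≡ inj₂ e → toℕ a ∸ n ≡ toℕ e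
    edge∸ {a} eq = trans (cong (_∸ n) (toℕ-inj₂ {a} eq)) (m+n∸m≡n n _)

  adj-middle : ∀ a b → adj (middle (wheel n)) a b ≡ adjℕ (toℕ a) (toℕ b)
  adj-middle a b with splitAt n a in ea | splitAt n b in eb
  ... | inj₁ x | inj₁ y = sym (adjℕ-eval (toℕ a) (toℕ b) (vertex<ᵇ {a} ea) (vertex<ᵇ {b} eb))
  ... | inj₁ x | inj₂ e = trans (incident-toℕ x e) (sym (trans (adjℕ-eval (toℕ a) (toℕ b) (vertex<ᵇ {a} ea) (edge<ᵇ {b} eb))
                                                       (cong₂ incident (toℕ-inj₁ {a} ea) (edge∸ {b} eb))))
  ... | inj₂ e | inj₁ y = trans (incident-toℕ y e) (sym (trans (adjℕ-eval (toℕ a) (toℕ b) (edge<ᵇ {a} ea) (vertex<ᵇ {b} eb))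
                                                       (cong₂ incident (toℕ-inj₁ {b} eb) (edge∸ {a} ea))))
  ... | inj₂ e | inj₂ f = trans (edgesMeet-toℕ e f) (sym (trans (adjℕ-eval (toℕ a) (toℕ b) (edge<ᵇ {a} ea) (edge<ᵇ {b} eb))
                                                       (cong₂ edgesMeet (edge∸ {a} ea) (edge∸ {b} eb))))

  prev next rimEdge spokeEdge : ℕ → ℕ
  prev i = if i ≡ᵇ 1 then m else pred i
  next i = if i ≡ᵇ m then 1 else suc i
  rimEdge i = if i ≡ᵇ 1 then m else (if i ≡ᵇ m then suc m else m + i)
  spokeEdge i = pred i

  next-eval : ∀ i {b} → (i ≡ᵇ m) ≡ b → next i ≡ (if b then 1 else suc i)
  next-eval i refl = refl

  rimEdge-eval : ∀ i {b c} → (i ≡ᵇ 1) ≡ b → (i ≡ᵇ m) ≡ c → rimEdge i ≡ (if b then m else (if c then suc m else m + i))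
  rimEdge-eval i refl refl = refl

  data RimView : ℕ → Set where
    rim-first : RimView 1
    rim-last  : RimView m
    rim-inner : ∀ s → 2 + s < m → RimView (2 + s)

  rimView : ∀ i → InRim m i → RimView i
  rimView (suc zero)       _             = rim-first
  rimView (suc (suc s)) (_ , s≤s i≤m) with suc (suc s) ≟ m
  ... | yes refl = rim-last
  ... | no  i≢m  = rim-inner s (≤∧≢⇒< i≤m i≢m)

  next-last : next m ≡ 1
  next-last = next-eval m (≡ᵇ-refl m)

  next-inner : ∀ s → 2 + s < m → next (2 + s) ≡ 3 + s
  next-inner s lt = next-eval (2 + s) (<⇒≡ᵇ≡false lt)

  rimEdge-last : rimEdge m ≡ suc m
  rimEdge-last = rimEdge-eval m refl (≡ᵇ-refl m)

  rimEdge-inner : ∀ s → 2 + s < m → rimEdge (2 + s) ≡ m + (2 + s)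
  rimEdge-inner s lt = rimEdge-eval (2 + s) refl (<⇒≡ᵇ≡false lt)

  private
    spokes inners : List (ℕ × ℕ)
    spokes = map (0 ,_) (range 1 m)
    inners = map (λ i → (i , suc i)) (range 2 (2 + k))

    length-spokes : length spokes ≡ m
    length-spokes = length-map-range (0 ,_) 1 m

    lookup-after-spokes : ∀ t → lookupℕ (wheelEdgesℕ m) (m + t) ≡ lookupℕ ((1 , 2) ∷ (1 , m) ∷ inners) t
    lookup-after-spokes t =
      subst (λ w → lookupℕ (wheelEdgesℕ m) (w + t) ≡ lookupℕ ((1 , 2) ∷ (1 , m) ∷ inners) t)
            length-spokes (lookupℕ-++ʳ spokes _ t)

  opaque
    unfolding ends

    ends-spoke : ∀ t → t < m → ends t ≡ (0 , suc t)
    ends-spoke t t<m =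
      trans (lookupℕ-++ˡ spokes _ t (subst (t <_) (sym length-spokes) t<m))
            (lookupℕ-map-range (0 ,_) 1 m t t<m)

    ends-v₁v₂ : ends m ≡ (1 , 2)
    ends-v₁v₂ = subst (λ w → ends w ≡ (1 , 2)) (+-identityʳ m) (lookup-after-spokes 0)

    ends-v₁vₘ : ends (suc m) ≡ (1 , m)
    ends-v₁vₘ = subst (λ w → ends w ≡ (1 , m)) (+-comm m 1) (lookup-after-spokes 1)

    ends-inner : ∀ s → s < 2 + k → ends (m + (2 + s)) ≡ (2 + s , 3 + s)
    ends-inner s lt = trans (lookup-after-spokes (2 + s)) (lookupℕ-map-range (λ i → (i , suc i)) 2 (2 + k) s lt)

  data EdgeView : ℕ → Set where
    spoke-edge : ∀ t → t < m → EdgeView t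
    edge-v₁v₂  : EdgeView m
    edge-v₁vₘ  : EdgeView (suc m)
    inner-edge : ∀ s → s < 2 + k → EdgeView (m + (2 + s))

  edgeView : ∀ t → t < m + m → EdgeView t
  edgeView t lt with t <? m
  ... | yes t<m = spoke-edge t t<m
  ... | no  t≮m with m+[n∸m]≡n {m} {t} (≮⇒≥ t≮m)
  ... | eq with t ∸ m
  ... | zero        = subst EdgeView (trans (sym (+-identityʳ m)) eq) edge-v₁v₂
  ... | suc zero    = subst EdgeView (trans (+-comm 1 m) eq) edge-v₁vₘ
  ... | suc (suc s) =
    subst EdgeView eq (inner-edge s (s≤s⁻¹ (s≤s⁻¹ (+-cancelˡ-< m (2 + s) m (subst (_< m + m) (sym eq) lt)))))

  Incident : ℕ → ℕ → Set
  Incident x t = (x ≡ 0 × t < m) ⊎ (InRim m x × (t ≡ spokeEdge x ⊎ t ≡ rimEdge x ⊎ t ≡ rimEdge (prev x)))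

  incident-inv : ∀ x t → t < m + m → incident x t ≡ true → Incident x t
  incident-inv x t lt e with edgeView t lt
  ... | spoke-edge t t<m with incident-ends-inv x (ends-spoke t t<m) e
  ...   | inj₁ refl = inj₁ (refl , t<m)
  ...   | inj₂ refl = inj₂ ((s≤s z≤n , s≤s t<m) , inj₁ refl)
  incident-inv x t lt e | edge-v₁v₂
    with incident-ends-inv x ends-v₁v₂ e
  ...   | inj₁ refl = inj₂ ((s≤s z≤n , s≤s (s≤s z≤n)) , inj₂ (inj₁ refl))
  ...   | inj₂ refl = inj₂ ((s≤s z≤n , s≤s (s≤s (s≤s z≤n))) , inj₂ (inj₂ refl))
  incident-inv x t lt e | edge-v₁vₘ
    with incident-ends-inv x ends-v₁vₘ e
  ...   | inj₁ refl = inj₂ ((s≤s z≤n , s≤s (s≤s z≤n)) , inj₂ (inj₂ (sym rimEdge-last)))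
  ...   | inj₂ refl = inj₂ ((s≤s z≤n , ≤-refl) , inj₂ (inj₁ (sym rimEdge-last)))
  incident-inv x t lt e | inner-edge s s<
    with incident-ends-inv x (ends-inner s s<) e
  ...   | inj₁ refl = inj₂ ((s≤s z≤n , s≤s (≤-trans (n≤1+n _) (s≤s (s≤s s<)))) ,
                            inj₂ (inj₁ (sym (rimEdge-inner s (s≤s (s≤s s<))))))
  ...   | inj₂ refl = inj₂ ((s≤s z≤n , s≤s (s≤s (s≤s s<))) , inj₂ (inj₂ (sym (rimEdge-inner s (s≤s (s≤s s<))))))

  next-inRim : ∀ i → InRim m i → InRim m (next i)
  next-inRim i r with rimView i r
  ... | rim-first     = s≤s z≤n , s≤s (s≤s (s≤s z≤n))
  ... | rim-last      = subst (InRim m) (sym next-last) (s≤s z≤n , s≤s (s≤s z≤n))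
  ... | rim-inner s lt = subst (InRim m) (sym (next-inner s lt)) (s≤s z≤n , s≤s lt)

  prev-inRim : ∀ i → InRim m i → InRim m (prev i)
  prev-inRim i r with rimView i r
  ... | rim-first      = s≤s z≤n , ≤-refl
  ... | rim-last       = s≤s z≤n , s≤s (n≤1+n _)
  ... | rim-inner s lt = s≤s z≤n , s≤s (≤-trans (n≤1+n _) (<⇒≤ lt))

  next∘prev : ∀ i → InRim m i → next (prev i) ≡ i
  next∘prev i r with rimView i r
  ... | rim-first      = next-last
  ... | rim-last       = next-eval (3 + k) (<⇒≡ᵇ≡false {3 + k} {4 + k} ≤-refl)
  ... | rim-inner s lt = next-eval (1 + s) (<⇒≡ᵇ≡false (<-trans (n<1+n _) lt))

  prev∘next : ∀ i → InRim m i → prev (next i) ≡ i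
  prev∘next i r with rimView i r
  ... | rim-first      = refl
  ... | rim-last       = cong prev next-last
  ... | rim-inner s lt = cong prev (next-inner s lt)

  prev-≢ : ∀ i → InRim m i → prev i ≢ i
  prev-≢ i r with rimView i r
  ... | rim-first      = λ ()
  ... | rim-last       = λ e → <-irrefl e (n<1+n _)
  ... | rim-inner s lt = λ e → <-irrefl e (n<1+n _)

  sumFrom-prev : ∀ f → sumFrom (f ∘ prev) 1 m ≡ sumFrom f 1 m
  sumFrom-prev f = begin
      f m + sumFrom (f ∘ prev) 2 (3 + k)
    ≡⟨ cong (f m +_) (sumFrom-cong (f ∘ prev) (f ∘ pred) 2 (3 + k) prev≗pred) ⟩
      f m + sumFrom (f ∘ pred) 2 (3 + k)
    ≡⟨ cong (f m +_) (sumFrom-shift (f ∘ pred) 1 1 (3 + k)) ⟨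
      f m + sumFrom f 1 (3 + k)
    ≡⟨ +-comm (f m) _ ⟩
      sumFrom f 1 (3 + k) + f m
    ≡⟨ cong (sumFrom f 1 (3 + k) +_) (+-identityʳ (f m)) ⟨
      sumFrom f 1 (3 + k) + sumFrom f (1 + (3 + k)) 1
    ≡⟨ sumFrom-++ f 1 (3 + k) 1 ⟨
      sumFrom f 1 (3 + k + 1)
    ≡⟨ cong (sumFrom f 1) (+-comm (3 + k) 1) ⟩
      sumFrom f 1 m ∎
    where
    open ≡-Reasoning
    prev≗pred : ∀ i → InRange 2 (3 + k) i → f (prev i) ≡ f (pred i)
    prev≗pred (suc zero)    (s≤s () , _)
    prev≗pred (suc (suc i)) _ = refl

  cycle : Cycle m
  cycle = record
    { next = next ; prev = prev
    ; next-inRim = next-inRim ; prev-inRim = prev-inRim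
    ; next∘prev = next∘prev ; prev∘next = prev∘next ; prev-≢ = prev-≢
    ; sumFrom-prev = sumFrom-prev
    }

  data Element : ℕ → Set where
    vertex : ∀ i → i < n → Element i
    edge   : ∀ t → t < m + m → Element (n + t)

  element : ∀ u → u < N → Element u
  element u u<N with u <? n
  ... | yes u<n = vertex u u<n
  ... | no  u≮n = subst Element u≡n+t (edge (u ∸ n) (+-cancelˡ-< n _ _ (subst (_< N) (sym u≡n+t) u<N)))
    where
    u≡n+t : n + (u ∸ n) ≡ u
    u≡n+t = m+[n∸m]≡n (≮⇒≥ u≮n)

  vertex<N : ∀ i → i < n → i < N
  vertex<N i i<n = ≤-trans i<n (m≤m+n n (m + m))

  edge<N : ∀ t → t < m + m → n + t < N
  edge<N t t< = +-monoʳ-< n t<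

  spokeEdge< : ∀ i → InRim m i → spokeEdge i < m + m
  spokeEdge< (suc i) (_ , s≤s i<m) = ≤-trans i<m (m≤m+n m m)

  rimEdge< : ∀ i → InRim m i → rimEdge i < m + m
  rimEdge< i r with rimView i r
  ... | rim-first      = m<m+n m (s≤s z≤n)
  ... | rim-last       = subst (_< m + m) (sym rimEdge-last)
                           (subst (_< m + m) (+-comm m 1) (+-monoʳ-< m {1} {m} (s≤s (s≤s z≤n))))
  ... | rim-inner s lt = subst (_< m + m) (sym (rimEdge-inner s lt)) (+-monoʳ-< m lt)

  private
    n+t<ᵇn : ∀ t → (n + t <ᵇ n) ≡ false
    n+t<ᵇn t = ≥⇒<ᵇ≡false (n + t) n (m≤m+n n t)

  adjℕ-vertex-vertex : ∀ i j → i < n → j < n → adjℕ i j ≡ false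
  adjℕ-vertex-vertex i j i<n j<n = adjℕ-eval i j (<⇒<ᵇ≡true i n i<n) (<⇒<ᵇ≡true j n j<n)

  adjℕ-vertex-edge : ∀ i t → i < n → adjℕ i (n + t) ≡ incident i t
  adjℕ-vertex-edge i t i<n = trans (adjℕ-eval i (n + t) (<⇒<ᵇ≡true i n i<n) (n+t<ᵇn t)) (cong (incident i) (m+n∸m≡n n t))

  adjℕ-edge-vertex : ∀ t i → i < n → adjℕ (n + t) i ≡ incident i t
  adjℕ-edge-vertex t i i<n = trans (adjℕ-eval (n + t) i (n+t<ᵇn t) (<⇒<ᵇ≡true i n i<n)) (cong (incident i) (m+n∸m≡n n t))

  adjℕ-edge-edge : ∀ t t′ → adjℕ (n + t) (n + t′) ≡ edgesMeet t t′
  adjℕ-edge-edge t t′ =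
    trans (adjℕ-eval (n + t) (n + t′) (n+t<ᵇn t) (n+t<ᵇn t′)) (cong₂ edgesMeet (m+n∸m≡n n t) (m+n∸m≡n n t′))

  edgesMeet-inv : ∀ t t′ → edgesMeet t t′ ≡ true →
    t ≢ t′ × (incident (proj₁ (ends t)) t′ ≡ true ⊎ incident (proj₂ (ends t)) t′ ≡ true)
  edgesMeet-inv t t′ e =
    (λ t≡t′ → true≢false (subst (λ w → (t ≡ᵇ w) ≡ true) t≡t′ (≡ᵇ-refl t)) t≢ᵇt′) ,
    ∨-elim (not-∧-elim t≢ᵇt′ e)
    where
    t≢ᵇt′ : (t ≡ᵇ t′) ≡ false
    t≢ᵇt′ = not-∧-elimˡ e

  edgesMeet-intro : ∀ t t′ → t ≢ t′ → ∀ x → incident x t ≡ true → incident x t′ ≡ true → edgesMeet t t′ ≡ true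
  edgesMeet-intro t t′ t≢t′ x x∈t x∈t′ with ∨-≡ᵇ-elim x _ _ x∈t
  ... | inj₁ refl = not-∧-intro (≢⇒≡ᵇ≡false t t′ t≢t′) (∨-introˡ (incident (proj₂ (ends t)) t′) x∈t′)
  ... | inj₂ refl = not-∧-intro (≢⇒≡ᵇ≡false t t′ t≢t′) (∨-introʳ (incident (proj₁ (ends t)) t′) x∈t′)

  incident-end₁ : ∀ {t a b} → ends t ≡ (a , b) → incident a t ≡ true
  incident-end₁ {t} {a} e =
    subst (λ p → ((a ≡ᵇ proj₁ p) ∨ (a ≡ᵇ proj₂ p)) ≡ true) (sym e) (∨-introˡ _ (≡ᵇ-refl a))

  incident-end₂ : ∀ {t a b} → ends t ≡ (a , b) → incident b t ≡ true
  incident-end₂ {t} {a} {b} e =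
    subst (λ p → ((b ≡ᵇ proj₁ p) ∨ (b ≡ᵇ proj₂ p)) ≡ true) (sym e) (∨-introʳ _ (≡ᵇ-refl b))

  incident-hub : ∀ t → t < m → incident 0 t ≡ true
  incident-hub t t<m = incident-end₁ (ends-spoke t t<m)

  incident-spoke : ∀ t → t < m → incident (suc t) t ≡ true
  incident-spoke t t<m = incident-end₂ (ends-spoke t t<m)

  ends-rimEdge : ∀ i → InRim m i → ends (rimEdge i) ≡ (i , next i) ⊎ ends (rimEdge i) ≡ (next i , i)
  ends-rimEdge i r with rimView i r
  ... | rim-first      = inj₁ ends-v₁v₂
  ... | rim-last       = inj₂ (trans (cong ends rimEdge-last) (trans ends-v₁vₘ (cong (_, m) (sym next-last))))
  ... | rim-inner s lt = inj₁ (trans (cong ends (rimEdge-inner s lt))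
                                     (trans (ends-inner s (s≤s⁻¹ (s≤s⁻¹ lt))) (cong (2 + s ,_) (sym (next-inner s lt)))))

  incident-rimEdge : ∀ i → InRim m i → incident i (rimEdge i) ≡ true
  incident-rimEdge i r with ends-rimEdge i r
  ... | inj₁ e = incident-end₁ e
  ... | inj₂ e = incident-end₂ e

  incident-rimEdge-next : ∀ i → InRim m i → incident (next i) (rimEdge i) ≡ true
  incident-rimEdge-next i r with ends-rimEdge i r
  ... | inj₁ e = incident-end₂ e
  ... | inj₂ e = incident-end₁ e

  incident-rimEdge-inv : ∀ i → InRim m i → ∀ x → incident x (rimEdge i) ≡ true → x ≡ i ⊎ x ≡ next i
  incident-rimEdge-inv i r x e with ends-rimEdge i r
  ... | inj₁ p = incident-ends-inv x p e
  ... | inj₂ p with incident-ends-inv x p e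
  ...   | inj₁ x≡next = inj₂ x≡next
  ...   | inj₂ x≡i    = inj₁ x≡i

  rimEdge-meets : ∀ i → InRim m i → ∀ t →
    (incident (proj₁ (ends (rimEdge i))) t ≡ true ⊎ incident (proj₂ (ends (rimEdge i))) t ≡ true) →
    incident i t ≡ true ⊎ incident (next i) t ≡ true
  rimEdge-meets i r t h with ends-rimEdge i r
  ... | inj₁ p rewrite p = h
  ... | inj₂ p rewrite p with h
  ...   | inj₁ e = inj₂ e
  ...   | inj₂ e = inj₁ e

  InRim⇒≢0 : ∀ {i} → InRim m i → i ≢ 0
  InRim⇒≢0 (s≤s _ , _) ()

  sumFrom-spokeEdge : ∀ f → sumFrom (λ i → f (n + spokeEdge i)) 1 m ≡ sumFrom f n m
  sumFrom-spokeEdge f = begin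
      sumFrom (λ i → f (n + pred i)) 1 m
    ≡⟨ sumFrom-shift (λ i → f (n + pred i)) 1 0 m ⟨
      sumFrom (λ i → f (n + i)) 0 m
    ≡⟨ sumFrom-shift f n 0 m ⟩
      sumFrom f (n + 0) m
    ≡⟨ cong (λ a → sumFrom f a m) (+-identityʳ n) ⟩
      sumFrom f n m ∎
    where open ≡-Reasoning

  sumFrom-rimEdge : ∀ f → sumFrom (λ i → f (n + rimEdge i)) 1 m ≡ sumFrom f (n + m) m
  sumFrom-rimEdge f = begin
      f (n + m) + sumFrom g 2 (3 + k)
    ≡⟨ cong (λ l → f (n + m) + sumFrom g 2 l) (+-comm 1 (2 + k)) ⟩
      f (n + m) + sumFrom g 2 (2 + k + 1)
    ≡⟨ cong (f (n + m) +_) (sumFrom-++ g 2 (2 + k) 1) ⟩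
      f (n + m) + (sumFrom g 2 (2 + k) + (f (n + rimEdge m) + 0))
    ≡⟨ cong₂ (λ a b → f (n + m) + (a + (f (n + b) + 0))) inner rimEdge-last ⟩
      f (n + m) + (sumFrom f (2 + (n + m)) (2 + k) + (f (n + suc m) + 0))
    ≡⟨ cong (λ c → f (n + m) + (sumFrom f (2 + (n + m)) (2 + k) + c)) (trans (+-identityʳ _) (cong f (+-suc n m))) ⟩
      f (n + m) + (sumFrom f (2 + (n + m)) (2 + k) + f (1 + (n + m)))
    ≡⟨ cong (f (n + m) +_) (+-comm _ (f (1 + (n + m)))) ⟩
      sumFrom f (n + m) m ∎
    where
    open ≡-Reasoning
    g = λ i → f (n + rimEdge i)
    inner : sumFrom g 2 (2 + k) ≡ sumFrom f (2 + (n + m)) (2 + k)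
    inner = begin
        sumFrom g 2 (2 + k)
      ≡⟨ sumFrom-cong g (λ i → f (n + m + i)) 2 (2 + k) g≗ ⟩
        sumFrom (λ i → f (n + m + i)) 2 (2 + k)
      ≡⟨ sumFrom-shift f (n + m) 2 (2 + k) ⟩
        sumFrom f (n + m + 2) (2 + k)
      ≡⟨ cong (λ a → sumFrom f a (2 + k)) (+-comm (n + m) 2) ⟩
        sumFrom f (2 + (n + m)) (2 + k) ∎
      where
      g≗ : ∀ i → InRange 2 (2 + k) i → g i ≡ f (n + m + i)
      g≗ (suc zero)    (s≤s () , _)
      g≗ (suc (suc s)) (_ , lt) = trans (cong (λ w → f (n + w)) (rimEdge-inner s lt)) (cong f (sym (+-assoc n m (2 + s))))

  sumFrom-elements : ∀ f → sumFrom f 0 N ≡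
    f 0 + (sumFrom f 1 m + (sumFrom (λ i → f (n + spokeEdge i)) 1 m + sumFrom (λ i → f (n + rimEdge i)) 1 m))
  sumFrom-elements f = begin
      f 0 + sumFrom f 1 (m + (m + m))
    ≡⟨ cong (f 0 +_) (trans (sumFrom-++ f 1 m (m + m)) (cong (sumFrom f 1 m +_) (sumFrom-++ f n m m))) ⟩
      f 0 + (sumFrom f 1 m + (sumFrom f n m + sumFrom f (n + m) m))
    ≡⟨ cong₂ (λ a b → f 0 + (sumFrom f 1 m + (a + b))) (sumFrom-spokeEdge f) (sumFrom-rimEdge f) ⟨
      f 0 + (sumFrom f 1 m + (sumFrom (λ i → f (n + spokeEdge i)) 1 m + sumFrom (λ i → f (n + rimEdge i)) 1 m)) ∎
    where open ≡-Reasoning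

  m≤rimEdge : ∀ i → InRim m i → m ≤ rimEdge i
  m≤rimEdge i r with rimView i r
  ... | rim-first      = ≤-refl
  ... | rim-last       = subst (m ≤_) (sym rimEdge-last) (n≤1+n m)
  ... | rim-inner s lt = subst (m ≤_) (sym (rimEdge-inner s lt)) (m≤m+n m (2 + s))

  rimEdge≢spokeEdge : ∀ i j → InRim m i → InRim m j → rimEdge i ≢ spokeEdge j
  rimEdge≢spokeEdge i (suc j) r (_ , s≤s j<m) e = <⇒≱ j<m (subst (m ≤_) e (m≤rimEdge i r))

  rimEdge-injective : ∀ i j → InRim m i → InRim m j → rimEdge i ≡ rimEdge j → i ≡ j
  rimEdge-injective i j rᵢ rⱼ = cases (rimView i rᵢ) (rimView j rⱼ)
    where
    m≢m+2+s : ∀ s → m ≢ m + (2 + s)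
    m≢m+2+s s e = m+1+n≢m m (sym e)
    1+m≢m+2+s : ∀ s → suc m ≢ m + (2 + s)
    1+m≢m+2+s s e = m+1+n≢m m (suc-injective (trans (sym (+-suc m (suc s))) (sym e)))
    cases : ∀ {i j} → RimView i → RimView j → rimEdge i ≡ rimEdge j → i ≡ j
    cases rim-first        rim-first        _ = refl
    cases rim-first        rim-last         e = contradiction (trans e rimEdge-last) (<⇒≢ (n<1+n m))
    cases rim-first        (rim-inner s lt) e = contradiction (trans e (rimEdge-inner s lt)) (m≢m+2+s s)
    cases rim-last         rim-first        e = contradiction (trans (sym e) rimEdge-last) (<⇒≢ (n<1+n m))
    cases rim-last         rim-last         _ = refl
    cases rim-last         (rim-inner s lt) e = contradiction (trans (sym rimEdge-last) (trans e (rimEdge-inner s lt))) (1+m≢m+2+s s)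
    cases (rim-inner s lt) rim-first        e = contradiction (trans (sym e) (rimEdge-inner s lt)) (m≢m+2+s s)
    cases (rim-inner s lt) rim-last         e = contradiction (trans (sym rimEdge-last) (trans (sym e) (rimEdge-inner s lt))) (1+m≢m+2+s s)
    cases (rim-inner s lt) (rim-inner t lt′) e =
      +-cancelˡ-≡ m _ _ (trans (sym (rimEdge-inner s lt)) (trans e (rimEdge-inner t lt′)))

  next-≢ : ∀ i → InRim m i → next i ≢ i
  next-≢ i r e = prev-≢ (next i) (next-inRim i r) (trans (prev∘next i r) (sym e))

  incident-prev-rimEdge : ∀ i → InRim m i → incident i (rimEdge (prev i)) ≡ true
  incident-prev-rimEdge i r =
    subst (λ x → incident x (rimEdge (prev i)) ≡ true) (next∘prev i r) (incident-rimEdge-next (prev i) (prev-inRim i r))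

  incident-spokeEdge : ∀ i → InRim m i → incident i (spokeEdge i) ≡ true
  incident-spokeEdge (suc t) (_ , s≤s t<m) = incident-spoke t t<m

  incident-hub-spokeEdge : ∀ i → InRim m i → incident 0 (spokeEdge i) ≡ true
  incident-hub-spokeEdge (suc t) (_ , s≤s t<m) = incident-hub t t<m

  spokes-meet : ∀ i j → InRim m i → InRim m j → i ≢ j → edgesMeet (spokeEdge i) (spokeEdge j) ≡ true
  spokes-meet (suc i) (suc j) rᵢ rⱼ i≢j =
    edgesMeet-intro i j (i≢j ∘ cong suc) 0 (incident-hub-spokeEdge (suc i) rᵢ) (incident-hub-spokeEdge (suc j) rⱼ)

  rim-meets-spoke : ∀ i → InRim m i → edgesMeet (rimEdge i) (spokeEdge i) ≡ true
  rim-meets-spoke i r =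
    edgesMeet-intro _ _ (rimEdge≢spokeEdge i i r r) i (incident-rimEdge i r) (incident-spokeEdge i r)

  rim-meets-next-spoke : ∀ i → InRim m i → edgesMeet (rimEdge i) (spokeEdge (next i)) ≡ true
  rim-meets-next-spoke i r = edgesMeet-intro _ _ (rimEdge≢spokeEdge i (next i) r (next-inRim i r)) (next i)
    (incident-rimEdge-next i r) (incident-spokeEdge (next i) (next-inRim i r))

  rim-meets-prev-rim : ∀ i → InRim m i → edgesMeet (rimEdge i) (rimEdge (prev i)) ≡ true
  rim-meets-prev-rim i r = edgesMeet-intro _ _ (prev-≢ i r ∘ sym ∘ rimEdge-injective i (prev i) r (prev-inRim i r)) i
    (incident-rimEdge i r) (incident-prev-rimEdge i r)

  rim-meets-next-rim : ∀ i → InRim m i → edgesMeet (rimEdge i) (rimEdge (next i)) ≡ true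
  rim-meets-next-rim i r = edgesMeet-intro _ _ (next-≢ i r ∘ sym ∘ rimEdge-injective i (next i) r (next-inRim i r)) (next i)
    (incident-rimEdge-next i r) (incident-rimEdge (next i) (next-inRim i r))

  data SpokeOrRim : ℕ → Set where
    is-spoke : ∀ i → InRim m i → SpokeOrRim (spokeEdge i)
    is-rim   : ∀ i → InRim m i → SpokeOrRim (rimEdge i)

  spokeOrRim : ∀ t → t < m + m → SpokeOrRim t
  spokeOrRim t t< with edgeView t t<
  ... | spoke-edge t t<m = is-spoke (suc t) (s≤s z≤n , s≤s t<m)
  ... | edge-v₁v₂        = is-rim 1 (s≤s z≤n , s≤s (s≤s z≤n))
  ... | edge-v₁vₘ        = subst SpokeOrRim rimEdge-last (is-rim m (s≤s z≤n , ≤-refl))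
  ... | inner-edge s s<  =
    subst SpokeOrRim (rimEdge-inner s (s≤s (s≤s s<))) (is-rim (2 + s) (s≤s z≤n , s≤s (s≤s (s≤s (<⇒≤ s<)))))

memberℕ : ∀ {N} → Subset N → ℕ → Bool
memberℕ []      _       = false
memberℕ (b ∷ v) zero    = b
memberℕ (b ∷ v) (suc j) = memberℕ v j

memberℕ-lookup : ∀ {N} (D : Subset N) (a : Fin N) → memberℕ D (toℕ a) ≡ lookupᵛ D a
memberℕ-lookup (b ∷ D) Fin.zero    = refl
memberℕ-lookup (b ∷ D) (Fin.suc a) = memberℕ-lookup D a

memberℕ-tabulate : ∀ {N} (h : ℕ → Bool) j → j < N → memberℕ (tabulate {n = N} (h ∘ toℕ)) j ≡ h j
memberℕ-tabulate {suc N} h zero    _         = refl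
memberℕ-tabulate {suc N} h (suc j) (s≤s j<N) = memberℕ-tabulate {N} (h ∘ suc) j j<N

∣∣-sumFrom : ∀ {N} (D : Subset N) → ∣ D ∣ ≡ sumFrom (bit ∘ memberℕ D) 0 N
∣∣-sumFrom []            = refl
∣∣-sumFrom {suc N} (b ∷ D) =
  trans (∣∷∣ b) (cong (bit b +_) (trans (∣∣-sumFrom D) (sumFrom-shift (bit ∘ memberℕ (b ∷ D)) 1 0 N)))
  where
  ∣∷∣ : ∀ b → ∣ b ∷ D ∣ ≡ bit b + ∣ D ∣
  ∣∷∣ true  = refl
  ∣∷∣ false = refl

module LowerBound (k : ℕ) (D : Subset (order (middle (wheel (5 + k))))) where
  open Wheel k

  inD : ℕ → Bool
  inD = memberℕ D

  spoke rim vtx : ℕ → Bool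
  spoke i = inD (n + spokeEdge i)
  rim   i = inD (n + rimEdge i)
  vtx   i = inD i

  ∣D∣≡ : ∣ D ∣ ≡ bit (inD 0) + sumFrom (λ i → blockSize (spoke i) (rim i) (vtx i)) 1 m
  ∣D∣≡ = begin
      ∣ D ∣
    ≡⟨ ∣∣-sumFrom D ⟩
      sumFrom f 0 (n + length E)
    ≡⟨ cong (sumFrom f 0) order≡N ⟩
      sumFrom f 0 N
    ≡⟨ sumFrom-elements f ⟩
      f 0 + (sumFrom (f ∘ vtx′) 1 m + (sumFrom (f ∘ spoke′) 1 m + sumFrom (f ∘ rim′) 1 m))
    ≡⟨ cong (f 0 +_) (regroup (sumFrom (f ∘ vtx′) 1 m) (sumFrom (f ∘ spoke′) 1 m) (sumFrom (f ∘ rim′) 1 m)) ⟩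
      f 0 + (sumFrom (f ∘ spoke′) 1 m + sumFrom (f ∘ rim′) 1 m + sumFrom (f ∘ vtx′) 1 m)
    ≡⟨ cong (λ s → f 0 + (s + sumFrom (f ∘ vtx′) 1 m)) (sumFrom-+ (f ∘ spoke′) (f ∘ rim′) 1 m) ⟨
      f 0 + (sumFrom (λ i → f (spoke′ i) + f (rim′ i)) 1 m + sumFrom (f ∘ vtx′) 1 m)
    ≡⟨ cong (f 0 +_) (sumFrom-+ (λ i → f (spoke′ i) + f (rim′ i)) (f ∘ vtx′) 1 m) ⟨
      f 0 + sumFrom (λ i → blockSize (spoke i) (rim i) (vtx i)) 1 m ∎
    where
    open ≡-Reasoning
    f = bit ∘ inD
    spoke′ rim′ vtx′ : ℕ → ℕ
    spoke′ i = n + spokeEdge i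
    rim′   i = n + rimEdge i
    vtx′   i = i
    regroup : ∀ z x y → z + (x + y) ≡ x + y + z
    regroup = solve-∀

  dominator : IsTotalDominating (middle (wheel n)) D →
    ∀ u → u < N → Σ ℕ λ w → w < N × inD w ≡ true × adjℕ u w ≡ true
  dominator td u u<N = from-Fin (td a)
    where
    u<order : u < n + length E
    u<order = subst (u <_) (sym order≡N) u<N
    a : Fin (n + length E)
    a = fromℕ< u<order
    from-Fin : (∃ λ w → w ∈ D × Adj (middle (wheel n)) a w) → Σ ℕ λ w → w < N × inD w ≡ true × adjℕ u w ≡ true
    from-Fin (w , w∈D , a~w) =
      toℕ w , subst (toℕ w <_) order≡N (toℕ<n w) , trans (memberℕ-lookup D w) ([]=⇒lookup w∈D) ,
      trans (cong (λ x → adjℕ x (toℕ w)) (sym (toℕ-fromℕ< u<order))) (trans (sym (adj-middle a w)) a~w)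

  module _ (td : IsTotalDominating (middle (wheel n)) D) where

    vertex-dominated : ∀ i → InRim m i → (spoke i ∨ rim (prev i) ∨ rim i) ≡ true
    vertex-dominated i r = from-dominator (dominator td i (vertex<N i (proj₂ r)))
      where
      Goal : Set
      Goal = (spoke i ∨ rim (prev i) ∨ rim i) ≡ true
      from-incident : ∀ t → Incident i t → inD (n + t) ≡ true → Goal
      from-incident t (inj₁ (i≡0 , _))           _   = contradiction i≡0 (InRim⇒≢0 r)
      from-incident _ (inj₂ (_ , inj₁ refl))        t∈D = ∨-introˡ _ t∈D
      from-incident _ (inj₂ (_ , inj₂ (inj₁ refl))) t∈D = ∨-introʳ (spoke i) (∨-introʳ (rim (prev i)) t∈D)
      from-incident _ (inj₂ (_ , inj₂ (inj₂ refl))) t∈D = ∨-introʳ (spoke i) (∨-introˡ _ t∈D)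
      from-element : ∀ w → Element w → inD w ≡ true → adjℕ i w ≡ true → Goal
      from-element _ (vertex j j<n) _   i~j = contradiction i~j (λ e → true≢false e (adjℕ-vertex-vertex i j (proj₂ r) j<n))
      from-element _ (edge t t<)    t∈D i~t =
        from-incident t (incident-inv i t t< (trans (sym (adjℕ-vertex-edge i t (proj₂ r))) i~t)) t∈D
      from-dominator : (Σ ℕ λ w → w < N × inD w ≡ true × adjℕ i w ≡ true) → Goal
      from-dominator (w , w<N , w∈D , i~w) = from-element w (element w w<N) w∈D i~w

    rim-dominated : ∀ i → InRim m i →
      (vtx i ∨ vtx (next i) ∨ spoke i ∨ spoke (next i) ∨ rim (prev i) ∨ rim (next i)) ≡ true
    rim-dominated i r = from-dominator (dominator td (n + rimEdge i) (edge<N _ (rimEdge< i r)))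
      where
      Goal : Set
      Goal = (vtx i ∨ vtx (next i) ∨ spoke i ∨ spoke (next i) ∨ rim (prev i) ∨ rim (next i)) ≡ true
      via-spoke : spoke i ≡ true → Goal
      via-spoke = ∨-introʳ (vtx i) ∘ ∨-introʳ (vtx (next i)) ∘ ∨-introˡ _
      via-spoke-next : spoke (next i) ≡ true → Goal
      via-spoke-next = ∨-introʳ (vtx i) ∘ ∨-introʳ (vtx (next i)) ∘ ∨-introʳ (spoke i) ∘ ∨-introˡ _
      via-rim-prev : rim (prev i) ≡ true → Goal
      via-rim-prev = ∨-introʳ (vtx i) ∘ ∨-introʳ (vtx (next i)) ∘ ∨-introʳ (spoke i) ∘ ∨-introʳ (spoke (next i))
                   ∘ ∨-introˡ _
      via-rim-next : rim (next i) ≡ true → Goal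
      via-rim-next = ∨-introʳ (vtx i) ∘ ∨-introʳ (vtx (next i)) ∘ ∨-introʳ (spoke i) ∘ ∨-introʳ (spoke (next i))
                   ∘ ∨-introʳ (rim (prev i))
      from-end : ∀ x → x ≡ i ⊎ x ≡ next i → inD x ≡ true → Goal
      from-end _ (inj₁ refl) x∈D = ∨-introˡ _ x∈D
      from-end _ (inj₂ refl) x∈D = ∨-introʳ (vtx i) (∨-introˡ _ x∈D)
      from-incident-i : ∀ t → rimEdge i ≢ t → Incident i t → inD (n + t) ≡ true → Goal
      from-incident-i t _ (inj₁ (i≡0 , _))          _   = contradiction i≡0 (InRim⇒≢0 r)
      from-incident-i _ _ (inj₂ (_ , inj₁ refl))        t∈D = via-spoke t∈D
      from-incident-i _ e≢t (inj₂ (_ , inj₂ (inj₁ refl))) _   = contradiction refl e≢t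
      from-incident-i _ _ (inj₂ (_ , inj₂ (inj₂ refl))) t∈D = via-rim-prev t∈D
      from-incident-next : ∀ t → rimEdge i ≢ t → Incident (next i) t → inD (n + t) ≡ true → Goal
      from-incident-next t _ (inj₁ (next≡0 , _))        _   = contradiction next≡0 (InRim⇒≢0 (next-inRim i r))
      from-incident-next _ _ (inj₂ (_ , inj₁ refl))        t∈D = via-spoke-next t∈D
      from-incident-next _ _ (inj₂ (_ , inj₂ (inj₁ refl))) t∈D = via-rim-next t∈D
      from-incident-next _ e≢t (inj₂ (_ , inj₂ (inj₂ refl))) _   = contradiction (cong rimEdge (sym (prev∘next i r))) e≢t
      from-meet : ∀ t → t < m + m → rimEdge i ≢ t → incident i t ≡ true ⊎ incident (next i) t ≡ true →
        inD (n + t) ≡ true → Goal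
      from-meet t t< e≢t (inj₁ e) = from-incident-i t e≢t (incident-inv i t t< e)
      from-meet t t< e≢t (inj₂ e) = from-incident-next t e≢t (incident-inv (next i) t t< e)
      from-element : ∀ w → Element w → inD w ≡ true → adjℕ (n + rimEdge i) w ≡ true → Goal
      from-element _ (vertex j j<n) j∈D e~j =
        from-end j (incident-rimEdge-inv i r j (trans (sym (adjℕ-edge-vertex (rimEdge i) j j<n)) e~j)) j∈D
      from-element _ (edge t t<) t∈D e~t = from-meet t t< (proj₁ meet) (rimEdge-meets i r t (proj₂ meet)) t∈D
        where meet = edgesMeet-inv (rimEdge i) t (trans (sym (adjℕ-edge-edge (rimEdge i) t)) e~t)
      from-dominator : (Σ ℕ λ w → w < N × inD w ≡ true × adjℕ (n + rimEdge i) w ≡ true) → Goal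
      from-dominator (w , w<N , w∈D , e~w) = from-element w (element w w<N) w∈D e~w

    hub-dominated : Σ ℕ λ j → InRim m j × spoke j ≡ true
    hub-dominated = from-dominator (dominator td 0 (vertex<N 0 (s≤s z≤n)))
      where
      Goal : Set
      Goal = Σ ℕ λ j → InRim m j × spoke j ≡ true
      from-incident : ∀ t → Incident 0 t → inD (n + t) ≡ true → Goal
      from-incident t (inj₁ (_ , t<m)) t∈D = suc t , (s≤s z≤n , s≤s t<m) , t∈D
      from-incident t (inj₂ (r , _))   _   = contradiction refl (InRim⇒≢0 r)
      from-element : ∀ w → Element w → inD w ≡ true → adjℕ 0 w ≡ true → Goal
      from-element _ (vertex j j<n) _   0~j = contradiction 0~j (λ e → true≢false e (adjℕ-vertex-vertex 0 j (s≤s z≤n) j<n))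
      from-element _ (edge t t<)    t∈D 0~t =
        from-incident t (incident-inv 0 t t< (trans (sym (adjℕ-vertex-edge 0 t (s≤s z≤n))) 0~t)) t∈D
      from-dominator : (Σ ℕ λ w → w < N × inD w ≡ true × adjℕ 0 w ≡ true) → Goal
      from-dominator (w , w<N , w∈D , 0~w) = from-element w (element w w<N) w∈D 0~w

    spoke-dominated : ∀ j → InRim m j →
      inD 0 ≡ true ⊎ vtx j ≡ true ⊎ (Σ ℕ λ j′ → InRim m j′ × j′ ≢ j × spoke j′ ≡ true)
      ⊎ rim (prev j) ≡ true ⊎ rim j ≡ true
    spoke-dominated j@(suc j-1) r@(_ , s≤s j-1<m) =
      from-dominator (dominator td (n + j-1) (edge<N j-1 (spokeEdge< j r)))
      where
      Goal : Set
      Goal = inD 0 ≡ true ⊎ vtx j ≡ true ⊎ (Σ ℕ λ j′ → InRim m j′ × j′ ≢ j × spoke j′ ≡ true)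
             ⊎ rim (prev j) ≡ true ⊎ rim j ≡ true
      from-end : ∀ x → x ≡ 0 ⊎ x ≡ j → inD x ≡ true → Goal
      from-end _ (inj₁ refl) x∈D = inj₁ x∈D
      from-end _ (inj₂ refl) x∈D = inj₂ (inj₁ x∈D)
      from-incident-hub : ∀ t → j-1 ≢ t → Incident 0 t → inD (n + t) ≡ true → Goal
      from-incident-hub t e≢t (inj₁ (_ , t<m)) t∈D =
        inj₂ (inj₂ (inj₁ (suc t , (s≤s z≤n , s≤s t<m) , (λ e → e≢t (sym (suc-injective e))) , t∈D)))
      from-incident-hub t _ (inj₂ (0∈rim , _)) _ = contradiction refl (InRim⇒≢0 0∈rim)
      from-incident-j : ∀ t → j-1 ≢ t → Incident j t → inD (n + t) ≡ true → Goal
      from-incident-j _ e≢t (inj₂ (_ , inj₁ refl))        _   = contradiction refl e≢t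
      from-incident-j _ _ (inj₂ (_ , inj₂ (inj₁ refl))) t∈D = inj₂ (inj₂ (inj₂ (inj₂ t∈D)))
      from-incident-j _ _ (inj₂ (_ , inj₂ (inj₂ refl))) t∈D = inj₂ (inj₂ (inj₂ (inj₁ t∈D)))
      from-meet : ∀ t → t < m + m → j-1 ≢ t → incident 0 t ≡ true ⊎ incident j t ≡ true → inD (n + t) ≡ true → Goal
      from-meet t t< e≢t (inj₁ e) = from-incident-hub t e≢t (incident-inv 0 t t< e)
      from-meet t t< e≢t (inj₂ e) = from-incident-j t e≢t (incident-inv j t t< e)
      from-element : ∀ w → Element w → inD w ≡ true → adjℕ (n + j-1) w ≡ true → Goal
      from-element _ (vertex x x<n) x∈D e~x =
        from-end x (incident-ends-inv x (ends-spoke j-1 j-1<m) (trans (sym (adjℕ-edge-vertex j-1 x x<n)) e~x)) x∈D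
      from-element _ (edge t t<) t∈D e~t =
        from-meet t t< (proj₁ meet)
          (subst (λ p → incident (proj₁ p) t ≡ true ⊎ incident (proj₂ p) t ≡ true) (ends-spoke j-1 j-1<m) (proj₂ meet)) t∈D
        where meet = edgesMeet-inv j-1 t (trans (sym (adjℕ-edge-edge j-1 t)) e~t)
      from-dominator : (Σ ℕ λ w → w < N × inD w ≡ true × adjℕ (n + j-1) w ≡ true) → Goal
      from-dominator (w , w<N , w∈D , e~w) = from-element w (element w w<N) w∈D e~w

  lower-bound : IsTOCDS (middle (wheel n)) D → ⌈2n/3⌉ n ≤ ∣ D ∣
  lower-bound (td , _) = ⌈2n/3⌉-minimal n ∣ D ∣ (begin
      2 * n
    ≡⟨ *-suc 2 m ⟩
      2 + 2 * m
    ≡⟨ +-comm 2 (2 * m) ⟩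
      2 * m + 2
    ≤⟨ Discharging.size-bound cycle spoke rim vtx (inD 0)
         (vertex-dominated td) (rim-dominated td) (hub-dominated td) (spoke-dominated td) ⟩
      3 * (bit (inD 0) + sumFrom (λ i → blockSize (spoke i) (rim i) (vtx i)) 1 m)
    ≡⟨ cong (3 *_) ∣D∣≡ ⟨
      3 * ∣ D ∣ ∎)
    where open ≤-Reasoning

module UpperBound (k : ℕ) where
  open Wheel k

  rimChosen : ℕ → Bool
  rimChosen i = (2 <ᵇ i) ∧ notTwoMod3 i

  rimOfEdge : ℕ → ℕ
  rimOfEdge t = if t ≡ᵇ m then 1 else (if t ≡ᵇ suc m then m else t ∸ m)

  chosenEdge : ℕ → Bool
  chosenEdge t = if t <ᵇ m then (t <ᵇ 2) else rimChosen (rimOfEdge t)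

  chosen : ℕ → Bool
  chosen u = if u <ᵇ n then false else chosenEdge (u ∸ n)

  private
    chosen-eval : ∀ u {b} → (u <ᵇ n) ≡ b → chosen u ≡ (if b then false else chosenEdge (u ∸ n))
    chosen-eval u refl = refl

    chosenEdge-eval : ∀ t {b} → (t <ᵇ m) ≡ b → chosenEdge t ≡ (if b then (t <ᵇ 2) else rimChosen (rimOfEdge t))
    chosenEdge-eval t refl = refl

    rimOfEdge-eval : ∀ t {b c} → (t ≡ᵇ m) ≡ b → (t ≡ᵇ suc m) ≡ c →
      rimOfEdge t ≡ (if b then 1 else (if c then m else t ∸ m))
    rimOfEdge-eval t refl refl = refl

  chosen-vertex : ∀ i → i < n → chosen i ≡ false
  chosen-vertex i i<n = chosen-eval i (<⇒<ᵇ≡true i n i<n)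

  chosen-edge : ∀ t → chosen (n + t) ≡ chosenEdge t
  chosen-edge t = trans (chosen-eval (n + t) (≥⇒<ᵇ≡false (n + t) n (m≤m+n n t))) (cong chosenEdge (m+n∸m≡n n t))

  chosen-spoke : ∀ t → t < m → chosen (n + t) ≡ (t <ᵇ 2)
  chosen-spoke t t<m = trans (chosen-edge t) (chosenEdge-eval t (<⇒<ᵇ≡true t m t<m))

  chosen-rimEdge : ∀ i → InRim m i → chosen (n + rimEdge i) ≡ rimChosen i
  chosen-rimEdge i r = trans (chosen-edge (rimEdge i)) (chosenEdge-rimEdge (rimView i r))
    where
    chosenEdge-rimEdge : ∀ {i} → RimView i → chosenEdge (rimEdge i) ≡ rimChosen i
    chosenEdge-rimEdge rim-first =
      trans (chosenEdge-eval m (≥⇒<ᵇ≡false m m ≤-refl)) (cong rimChosen (rimOfEdge-eval m (≡ᵇ-refl m) refl))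
    chosenEdge-rimEdge rim-last = trans (cong chosenEdge rimEdge-last)
      (trans (chosenEdge-eval (suc m) (≥⇒<ᵇ≡false (suc m) m (n≤1+n m)))
             (cong rimChosen (rimOfEdge-eval (suc m) (>⇒≡ᵇ≡false (n<1+n m)) (≡ᵇ-refl (suc m)))))
    chosenEdge-rimEdge (rim-inner s lt) = trans (cong chosenEdge (rimEdge-inner s lt))
      (trans (chosenEdge-eval (m + (2 + s)) (≥⇒<ᵇ≡false _ m (m≤m+n m _)))
             (cong rimChosen (trans (rimOfEdge-eval (m + (2 + s)) (>⇒≡ᵇ≡false (m<m+n m (s≤s z≤n)))
                                                    (>⇒≡ᵇ≡false m+1<m+2+s))
                                    (m+n∸m≡n m (2 + s)))))
      where
      m+1<m+2+s : suc m < m + (2 + s)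
      m+1<m+2+s = subst (_< m + (2 + s)) (+-comm m 1) (+-monoʳ-< m {1} {2 + s} (s≤s (s≤s z≤n)))

  Dᵘ : Subset (order (middle (wheel n)))
  Dᵘ = tabulate (chosen ∘ toℕ)

  ∣Dᵘ∣ : ∣ Dᵘ ∣ ≡ ⌈2n/3⌉ n
  ∣Dᵘ∣ = begin
      ∣ Dᵘ ∣
    ≡⟨ ∣∣-sumFrom Dᵘ ⟩
      sumFrom (bit ∘ memberℕ Dᵘ) 0 (n + length E)
    ≡⟨ sumFrom-cong _ f 0 (n + length E) (λ u (_ , u<) → cong bit (memberℕ-tabulate chosen u u<)) ⟩
      sumFrom f 0 (n + length E)
    ≡⟨ cong (sumFrom f 0) order≡N ⟩
      sumFrom f 0 N
    ≡⟨ sumFrom-elements f ⟩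
      f 0 + (sumFrom f 1 m + (sumFrom (λ i → f (n + spokeEdge i)) 1 m + sumFrom (λ i → f (n + rimEdge i)) 1 m))
    ≡⟨ cong₂ (λ a b → f 0 + (a + b)) no-vertices (cong₂ _+_ two-spokes rims) ⟩
      2 + sumFrom (bit ∘ notTwoMod3) 3 (2 + k)
    ≡⟨ count-notTwoMod3 (2 + k) ⟩
      ⌈2n/3⌉ n ∎
    where
    open ≡-Reasoning
    f = bit ∘ chosen
    no-vertices : sumFrom f 1 m ≡ 0
    no-vertices = sumFrom-zero f 1 m (λ i (_ , i<n) → cong bit (chosen-vertex i i<n))
    two-spokes : sumFrom (λ i → f (n + spokeEdge i)) 1 m ≡ 2
    two-spokes = begin
        sumFrom (λ i → f (n + spokeEdge i)) 1 m
      ≡⟨ sumFrom-cong (λ i → f (n + spokeEdge i)) (λ i → bit (pred i <ᵇ 2)) 1 m spoke≗ ⟩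
        2 + sumFrom (λ i → bit (pred i <ᵇ 2)) 3 (2 + k)
      ≡⟨ cong (2 +_) (sumFrom-zero (λ i → bit (pred i <ᵇ 2)) 3 (2 + k) beyond-v₂) ⟩
        2 ∎
      where
      spoke≗ : ∀ i → InRim m i → f (n + spokeEdge i) ≡ bit (pred i <ᵇ 2)
      spoke≗ (suc i) (_ , s≤s i<m) = cong bit (chosen-spoke i i<m)
      beyond-v₂ : ∀ i → InRange 3 (2 + k) i → bit (pred i <ᵇ 2) ≡ 0
      beyond-v₂ (suc (suc (suc i))) _ = refl
      beyond-v₂ (suc (suc zero)) (s≤s (s≤s ()) , _)
      beyond-v₂ (suc zero) (s≤s () , _)
    rims : sumFrom (λ i → f (n + rimEdge i)) 1 m ≡ sumFrom (bit ∘ notTwoMod3) 3 (2 + k)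
    rims = begin
        sumFrom (λ i → f (n + rimEdge i)) 1 m
      ≡⟨ sumFrom-cong (λ i → f (n + rimEdge i)) (bit ∘ rimChosen) 1 m (λ i r → cong bit (chosen-rimEdge i r)) ⟩
        sumFrom (bit ∘ rimChosen) 1 m
      ≡⟨ sumFrom-cong (bit ∘ rimChosen) (bit ∘ notTwoMod3) 3 (2 + k) beyond-v₂ ⟩
        sumFrom (bit ∘ notTwoMod3) 3 (2 + k) ∎
      where
      beyond-v₂ : ∀ i → InRange 3 (2 + k) i → bit (rimChosen i) ≡ bit (notTwoMod3 i)
      beyond-v₂ (suc (suc (suc i))) _ = refl
      beyond-v₂ (suc (suc zero)) (s≤s (s≤s ()) , _)
      beyond-v₂ (suc zero) (s≤s () , _)

  rimChosen-prev : ∀ s → rimChosen (3 + s) ≡ false → rimChosen (2 + s) ≡ true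
  rimChosen-prev (suc s) e = notTwoMod3-pred (3 + s) e

  rimChosen-next : ∀ s → rimChosen (2 + s) ≡ false → rimChosen (4 + s) ≡ true
  rimChosen-next zero    _ = refl
  rimChosen-next (suc s) e = notTwoMod3-+2 (3 + s) e

  1∈rim : InRim m 1
  1∈rim = s≤s z≤n , s≤s (s≤s z≤n)

  2∈rim : InRim m 2
  2∈rim = s≤s z≤n , s≤s (s≤s (s≤s z≤n))

  chosen-spoke₁ : chosen (n + spokeEdge 1) ≡ true
  chosen-spoke₁ = chosen-spoke 0 (s≤s z≤n)

  chosen-spoke₂ : chosen (n + spokeEdge 2) ≡ true
  chosen-spoke₂ = chosen-spoke 1 (s≤s (s≤s z≤n))

  Dominated : ℕ → Set
  Dominated u = Σ ℕ λ w → w < N × chosen w ≡ true × adjℕ u w ≡ true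

  by-spoke : ∀ u i → InRim m i → chosen (n + spokeEdge i) ≡ true → adjℕ u (n + spokeEdge i) ≡ true → Dominated u
  by-spoke u i r c u~ = n + spokeEdge i , edge<N _ (spokeEdge< i r) , c , u~

  by-rim : ∀ u i → InRim m i → rimChosen i ≡ true → adjℕ u (n + rimEdge i) ≡ true → Dominated u
  by-rim u i r c u~ = n + rimEdge i , edge<N _ (rimEdge< i r) , trans (chosen-rimEdge i r) c , u~

  vertex-by-spoke : ∀ x i → x < n → InRim m i → chosen (n + spokeEdge i) ≡ true → incident x (spokeEdge i) ≡ true →
    Dominated x
  vertex-by-spoke x i x<n r c x∈ = by-spoke x i r c (trans (adjℕ-vertex-edge x (spokeEdge i) x<n) x∈)

  vertex-by-rim : ∀ x i → x < n → InRim m i → rimChosen i ≡ true → incident x (rimEdge i) ≡ true → Dominated x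
  vertex-by-rim x i x<n r c x∈ = by-rim x i r c (trans (adjℕ-vertex-edge x (rimEdge i) x<n) x∈)

  edge-by-spoke : ∀ t i → InRim m i → chosen (n + spokeEdge i) ≡ true → edgesMeet t (spokeEdge i) ≡ true →
    Dominated (n + t)
  edge-by-spoke t i r c meet = by-spoke (n + t) i r c (trans (adjℕ-edge-edge t (spokeEdge i)) meet)

  edge-by-rim : ∀ t i → InRim m i → rimChosen i ≡ true → edgesMeet t (rimEdge i) ≡ true → Dominated (n + t)
  edge-by-rim t i r c meet = by-rim (n + t) i r c (trans (adjℕ-edge-edge t (rimEdge i)) meet)

  vertex-dominated : ∀ i → i < n → Dominated i
  vertex-dominated 0 0<n = vertex-by-spoke 0 1 0<n 1∈rim chosen-spoke₁ (incident-hub-spokeEdge 1 1∈rim)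
  vertex-dominated 1 1<n = vertex-by-spoke 1 1 1<n 1∈rim chosen-spoke₁ (incident-spokeEdge 1 1∈rim)
  vertex-dominated 2 2<n = vertex-by-spoke 2 2 2<n 2∈rim chosen-spoke₂ (incident-spokeEdge 2 2∈rim)
  vertex-dominated i@(suc (suc (suc s))) i<n = by-own-or-prev-rim (bool-cases (rimChosen i))
    where
    r : InRim m i
    r = s≤s z≤n , i<n
    by-own-or-prev-rim : rimChosen i ≡ true ⊎ rimChosen i ≡ false → Dominated i
    by-own-or-prev-rim (inj₁ c) = vertex-by-rim i i i<n r c (incident-rimEdge i r)
    by-own-or-prev-rim (inj₂ c) = vertex-by-rim i (prev i) i<n (prev-inRim i r) (rimChosen-prev s c) (incident-prev-rimEdge i r)

  rim-dominated : ∀ i → InRim m i → RimView i → Dominated (n + rimEdge i)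
  rim-dominated i r rim-first = edge-by-spoke (rimEdge 1) 1 1∈rim chosen-spoke₁ (rim-meets-spoke 1 r)
  rim-dominated i r rim-last  = edge-by-spoke (rimEdge m) 1 1∈rim chosen-spoke₁
    (subst (λ j → edgesMeet (rimEdge m) (spokeEdge j) ≡ true) next-last (rim-meets-next-spoke m r))
  rim-dominated i r (rim-inner zero _) = edge-by-spoke (rimEdge 2) 2 2∈rim chosen-spoke₂ (rim-meets-spoke 2 r)
  rim-dominated i r (rim-inner (suc s) lt) = by-prev-or-next-rim (bool-cases (rimChosen (2 + s)))
    where
    by-prev-or-next-rim : rimChosen (2 + s) ≡ true ⊎ rimChosen (2 + s) ≡ false → Dominated (n + rimEdge i)
    by-prev-or-next-rim (inj₁ c) = edge-by-rim (rimEdge i) (prev i) (prev-inRim i r) c (rim-meets-prev-rim i r)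
    by-prev-or-next-rim (inj₂ c) = edge-by-rim (rimEdge i) (next i) (next-inRim i r)
      (subst (λ j → rimChosen j ≡ true) (sym (next-inner (suc s) lt)) (rimChosen-next s c)) (rim-meets-next-rim i r)

  edge-dominated : ∀ {t} → SpokeOrRim t → Dominated (n + t)
  edge-dominated (is-spoke 1 r) =
    edge-by-spoke (spokeEdge 1) 2 2∈rim chosen-spoke₂ (spokes-meet 1 2 r 2∈rim (λ ()))
  edge-dominated (is-spoke i@(suc (suc _)) r) =
    edge-by-spoke (spokeEdge i) 1 1∈rim chosen-spoke₁ (spokes-meet i 1 r 1∈rim (λ ()))
  edge-dominated (is-rim i r) = rim-dominated i r (rimView i r)

  dominated : ∀ u → u < N → Dominated u
  dominated u u<N = by-element (element u u<N)
    where
    by-element : ∀ {u} → Element u → Dominated u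
    by-element (vertex i i<n) = vertex-dominated i i<n
    by-element (edge t t<)    = edge-dominated (spokeOrRim t t<)

  data HubWalk : ℕ → Set where
    at-hub : HubWalk 0
    step   : ∀ {u w} → chosen u ≡ false → u < N → adjℕ u w ≡ true → HubWalk w → HubWalk u

  HubWalk-< : ∀ {u} → HubWalk u → u < N
  HubWalk-< at-hub           = s≤s z≤n
  HubWalk-< (step _ u<N _ _) = u<N

  3∈rim : InRim m 3
  3∈rim = s≤s z≤n , s≤s (s≤s (s≤s (s≤s z≤n)))

  spoke-walk : ∀ i → 3 ≤ i → InRim m i → HubWalk (n + spokeEdge i)
  spoke-walk i@(suc t) (s≤s 2≤t) r@(_ , s≤s t<m) =
    step (trans (chosen-spoke t t<m) (≥⇒<ᵇ≡false t 2 2≤t)) (edge<N t (spokeEdge< i r))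
         (trans (adjℕ-edge-vertex t 0 (s≤s z≤n)) (incident-hub t t<m)) at-hub

  rim-walk : ∀ i → 3 ≤ i → InRim m i → chosen (n + rimEdge i) ≡ false → HubWalk (n + rimEdge i)
  rim-walk i 3≤i r c = step c (edge<N _ (rimEdge< i r))
    (trans (adjℕ-edge-edge (rimEdge i) (spokeEdge i)) (rim-meets-spoke i r)) (spoke-walk i 3≤i r)

  rim₂-walk : HubWalk (n + rimEdge 2)
  rim₂-walk = step (chosen-rimEdge 2 2∈rim) (edge<N _ (rimEdge< 2 2∈rim))
    (trans (adjℕ-edge-edge (rimEdge 2) (spokeEdge 3)) (rim-meets-next-spoke 2 2∈rim)) (spoke-walk 3 ≤-refl 3∈rim)

  rim₁-walk : HubWalk (n + rimEdge 1)
  rim₁-walk = step (chosen-rimEdge 1 1∈rim) (edge<N _ (rimEdge< 1 1∈rim))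
    (trans (adjℕ-edge-edge (rimEdge 1) (rimEdge 2)) (rim-meets-next-rim 1 1∈rim)) rim₂-walk

  vertex-walk : ∀ i → i < n → HubWalk i
  vertex-walk 0 _ = at-hub
  vertex-walk 1 1<n = step (chosen-vertex 1 1<n) (vertex<N 1 1<n)
    (trans (adjℕ-vertex-edge 1 (rimEdge 1) 1<n) (incident-rimEdge 1 1∈rim)) rim₁-walk
  vertex-walk 2 2<n = step (chosen-vertex 2 2<n) (vertex<N 2 2<n)
    (trans (adjℕ-vertex-edge 2 (rimEdge 2) 2<n) (incident-rimEdge 2 2∈rim)) rim₂-walk
  vertex-walk i@(suc (suc (suc _))) i<n = step (chosen-vertex i i<n) (vertex<N i i<n)
    (trans (adjℕ-vertex-edge i (spokeEdge i) i<n) (incident-spokeEdge i r)) (spoke-walk i (s≤s (s≤s (s≤s z≤n))) r)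
    where
    r : InRim m i
    r = s≤s z≤n , i<n

  edge-walk : ∀ {t} → SpokeOrRim t → chosen (n + t) ≡ false → HubWalk (n + t)
  edge-walk (is-spoke 1 _) c = contradiction chosen-spoke₁ (λ e → true≢false e c)
  edge-walk (is-spoke 2 _) c = contradiction chosen-spoke₂ (λ e → true≢false e c)
  edge-walk (is-spoke i@(suc (suc (suc _))) r) _ = spoke-walk i (s≤s (s≤s (s≤s z≤n))) r
  edge-walk (is-rim 1 _) _ = rim₁-walk
  edge-walk (is-rim 2 _) _ = rim₂-walk
  edge-walk (is-rim i@(suc (suc (suc _))) r) c = rim-walk i (s≤s (s≤s (s≤s z≤n))) r c

  walk-to-hub : ∀ u → u < N → chosen u ≡ false → HubWalk u
  walk-to-hub u u<N = by-element (element u u<N)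
    where
    by-element : ∀ {u} → Element u → chosen u ≡ false → HubWalk u
    by-element (vertex i i<n) _ = vertex-walk i i<n
    by-element (edge t t<)    c = edge-walk (spokeOrRim t t<) c

  H : Graph
  H = middle (wheel n)

  toFin : ∀ {u} → u < N → Fin (order H)
  toFin {u} u<N = fromℕ< (subst (u <_) (sym order≡N) u<N)

  toℕ-toFin : ∀ {u} (u<N : u < N) → toℕ (toFin u<N) ≡ u
  toℕ-toFin {u} u<N = toℕ-fromℕ< (subst (u <_) (sym order≡N) u<N)

  toℕ<N : ∀ (a : Fin (order H)) → toℕ a < N
  toℕ<N a = subst (toℕ a <_) order≡N (toℕ<n a)

  adj-toFin : ∀ a {w} (w<N : w < N) → adjℕ (toℕ a) w ≡ true → Adj H a (toFin w<N)
  adj-toFin a w<N a~w = trans (adj-middle a (toFin w<N)) (trans (cong (adjℕ (toℕ a)) (toℕ-toFin w<N)) a~w)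

  lookup-Dᵘ : ∀ a → lookupᵛ Dᵘ a ≡ chosen (toℕ a)
  lookup-Dᵘ = lookup∘tabulate (chosen ∘ toℕ)

  ∈Dᵘ : ∀ a → chosen (toℕ a) ≡ true → a ∈ Dᵘ
  ∈Dᵘ a c = lookup⇒[]= a Dᵘ (trans (lookup-Dᵘ a) c)

  ∉Dᵘ : ∀ a → chosen (toℕ a) ≡ false → a ∉ Dᵘ
  ∉Dᵘ a c a∈ = true≢false (trans (sym (lookup-Dᵘ a)) ([]=⇒lookup a∈)) c

  ∉Dᵘ⇒unchosen : ∀ a → a ∉ Dᵘ → chosen (toℕ a) ≡ false
  ∉Dᵘ⇒unchosen a a∉ with bool-cases (chosen (toℕ a))
  ... | inj₁ c = contradiction (∈Dᵘ a c) a∉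
  ... | inj₂ c = c

  total-dominating : IsTotalDominating H Dᵘ
  total-dominating a = to-Fin (dominated (toℕ a) (toℕ<N a))
    where
    to-Fin : Dominated (toℕ a) → ∃ λ b → b ∈ Dᵘ × Adj H a b
    to-Fin (w , w<N , c , a~w) = toFin w<N , ∈Dᵘ _ (trans (cong chosen (toℕ-toFin w<N)) c) , adj-toFin a w<N a~w

  hub : Fin (order H)
  hub = Fin.zero

  walk-outside : ∀ {u} → HubWalk u → ∀ a → toℕ a ≡ u → WalkOutside H Dᵘ a hub
  walk-outside at-hub a a≡0 = subst (λ b → WalkOutside H Dᵘ b hub) (sym (toℕ-injective a≡0)) (here (∉Dᵘ hub refl))
  walk-outside (step c _ u~w p) a refl =
    step (∉Dᵘ a c) (adj-toFin a (HubWalk-< p) u~w) (walk-outside p (toFin (HubWalk-< p)) (toℕ-toFin (HubWalk-< p)))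

  outer-connected : OuterConnected H Dᵘ
  outer-connected = outerConnected-via (middle-symmetric (wheel n)) hub
    (λ a a∉ → walk-outside (walk-to-hub (toℕ a) (toℕ<N a) (∉Dᵘ⇒unchosen a a∉)) a refl)

theorem2p5 : (n : ℕ) → 5 ≤ n → GammaTC≡ (middle (wheel n)) (⌈2n/3⌉ n)
theorem2p5 _ (s≤s (s≤s (s≤s (s≤s (s≤s (z≤n {k})))))) =
  (Dᵘ , (total-dominating , outer-connected) , ∣Dᵘ∣) , LowerBound.lower-bound k
  where open UpperBound k
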